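{- (1) For every positive integer $r$ and every integer $n\ge 0$, \[\mathcal{E}_{4n+2^{r+1}}^{(4,0)}\equiv \mathcal{E}_{4n}^{(4,0)} \pmod{2^r}.\] (2) For every positive integer $r$ there is a positive integer $n_0$ such that for all $n\ge n_0$, \[\mathcal{E}_{6n+2\cdot 3^r}^{(6,0)}\equiv \mathcal{E}_{6n}^{(6,0)} \pmod{3^r}.\]
   Context: For integers $N\ge 1$ and $j\ge 0$, the congruential Euler numbers $\mathcal{E}_n^{(N,j)}$ ($n\ge 0$) are defined by the identity of formal power series \[\sum_{n=0}^\infty \mathcal{E}_n^{(N,j)}\frac{z^n}{n!}=\left(\sum_{n=0}^\infty \frac{z^{Nn}}{(Nn+j)!}\right)^{ -1}.\] For $j=0$ these are integers. -}

module Defs where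

open import Data.Nat using (ℕ; zero; suc; _∸_)
open import Data.Nat.Divisibility using (_∣?_)
open import Data.Nat.Combinatorics using (_C_)
open import Data.Integer using (ℤ; +_; -_; _+_; _*_; _-_)
open import Data.Fin using (Fin; toℕ)
open import Data.Vec using (Vec; []; _∷ʳ_; lookup; last)
open import Relation.Nullary using (yes; no)

-- Congruential Euler numbers with j = 0.
-- Comparing coefficients of z^n/n! in
--   (Σ_n E_n z^n/n!) · (Σ_m z^{Nm}/(Nm)!) = 1
-- gives  Σ_{k ≤ n, N ∣ n-k} C(n,k) E_k = δ_{n,0}, i.e.
--   E_0 = 1,   E_n = - Σ_{k < n, N ∣ n-k} C(n,k) E_k   (n ≥ 1).

term : ℕ → (n k : ℕ) → ℤ → ℤ
term N n k e with N ∣? (n ∸ k)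
... | yes _ = + (n C k) * e
... | no  _ = + 0

sumFin : ∀ {m} → (Fin m → ℤ) → ℤ
sumFin {zero}  f = + 0
sumFin {suc m} f = f Fin.zero + sumFin (λ i → f (Fin.suc i))
  where import Data.Fin as Fin

next : ℕ → (n : ℕ) → Vec ℤ n → ℤ
next N zero    v = + 1
next N (suc n) v = - sumFin (λ (k : Fin (suc n)) → term N (suc n) (toℕ k) (lookup v k))

hist : ℕ → (n : ℕ) → Vec ℤ n
hist N zero    = []
hist N (suc n) = hist N n ∷ʳ next N n (hist N n)

𝓔 : ℕ → ℕ → ℤ
𝓔 N n = next N n (hist N n)

-- Read a sequence a : ℕ → ℤ as the exponential generating function Σ a n zⁿ/n!, so that 𝓔 N is
-- the inverse of c_N(z) = Σ z^{Nn}/(Nn)!.  Put φ_N = e^{-z} c_N; since (D^N - 1) c_N = 0 we have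
-- ((D + 1)^N - 1) φ_N = 0, and this recurrence makes the derivatives of φ_N divisible by growing
-- powers of 2 (N = 4) or 3 (N = 3).  By Leibniz, D^d (w ψ) ≡ (D^d w) ψ mod q as soon as
-- C(d,i) ψ^{(i)} ≡ 0 mod q for all i ≥ 1; for q = p^R dividing d this follows from
-- i C(d,i) = d C(d-1,i-1) once p^a divides ψ^{(i)} whenever p^a ≤ i.
--
-- N = 4: 𝓔₄ = e^{-z} + 𝓔₄ (1 - φ₄), so strong induction transfers the period 2^{r+1} of e^{-z}
-- modulo 2^r to 𝓔₄.
--
-- N = 6: with U(z) = -e^{-2z} φ₃(-z) one has 𝓔₆ (φ₃ - U) = 2e^{-z}.  Since D(V³) = 3V²DV, the
-- non-constant coefficients of V^{3^r} are divisible by 3^r, so φ₃^{3^r} - U^{3^r} ≡ 2 mod 3^r and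
-- 𝓔₆ ≡ e^{-z}(φ₃^{3^r} - U^{3^r})/(φ₃ - U) mod 3^r.  The right-hand side is a sum of products of
-- exponentials, φ₃ and φ₃(-z); exponentials are eventually periodic mod 3^r with period 2·3^r, and
-- multiplication by φ₃ or φ₃(-z) preserves this.

module Submission where

open import Defs
open import Relation.Binary.PropositionalEquality

module BinomialValuation where

  open import Data.Nat
  open import Data.Nat.Properties
  open import Data.Nat.Divisibility
  open import Data.Nat.Primality using (Prime; euclidsLemma; prime⇒nonZero)
  open import Data.Nat.Combinatorics using (_C_; nC1≡n; nCk+nC[k+1]≡[n+1]C[k+1])
  open import Data.Nat.Tactic.RingSolver using (solve-∀)
  open import Data.Sum using (inj₁; inj₂)
  open import Relation.Nullary using (¬_; yes; no; contradiction)

  [1+k]*[1+n]C[1+k]≡[1+n]*nCk : ∀ n k → suc k * (suc n C suc k) ≡ suc n * (n C k)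
  [1+k]*[1+n]C[1+k]≡[1+n]*nCk zero    zero    = refl
  [1+k]*[1+n]C[1+k]≡[1+n]*nCk zero    (suc k) = *-zeroʳ (suc (suc k))
  [1+k]*[1+n]C[1+k]≡[1+n]*nCk (suc n) zero    =
    trans (*-identityˡ _) (trans (nC1≡n (suc (suc n))) (sym (*-identityʳ (suc (suc n)))))
  [1+k]*[1+n]C[1+k]≡[1+n]*nCk (suc n) (suc k) = begin
    suc (suc k) * (suc (suc n) C suc (suc k))
      ≡⟨ cong (suc (suc k) *_) (nCk+nC[k+1]≡[n+1]C[k+1] (suc n) (suc k)) ⟨
    suc (suc k) * (B + B′)
      ≡⟨ expand k B B′ ⟩
    suc k * B + B + suc (suc k) * B′
      ≡⟨ cong₂ (λ u v → u + B + v) ([1+k]*[1+n]C[1+k]≡[1+n]*nCk n k) ([1+k]*[1+n]C[1+k]≡[1+n]*nCk n (suc k)) ⟩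
    suc n * (n C k) + B + suc n * (n C suc k)
      ≡⟨ regroup (suc n) (n C k) (n C suc k) B ⟩
    B + suc n * (n C k + n C suc k)
      ≡⟨ cong (λ u → B + suc n * u) (nCk+nC[k+1]≡[n+1]C[k+1] n k) ⟩
    suc (suc n) * B
      ∎
    where
    open ≡-Reasoning
    B = suc n C suc k
    B′ = suc n C suc (suc k)
    expand : ∀ k x y → suc (suc k) * (x + y) ≡ suc k * x + x + suc (suc k) * y
    expand = solve-∀
    regroup : ∀ m x y b → m * x + b + m * y ≡ b + m * (x + y)
    regroup = solve-∀

  module _ {p} (p-prime : Prime p) where

    private instance
      p≢0 : NonZero p
      p≢0 = prime⇒nonZero p-prime

    p∤t⇒p^R∣t*x⇒p^R∣x : ∀ R {t x} → ¬ p ∣ t → p ^ R ∣ t * x → p ^ R ∣ x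
    p∤t⇒p^R∣t*x⇒p^R∣x zero    {x = x} _ _ = 1∣ x
    p∤t⇒p^R∣t*x⇒p^R∣x (suc R) {t} {x} p∤t p^[1+R]∣tx
      with euclidsLemma t x p-prime (∣-trans (m∣m*n (p ^ R)) p^[1+R]∣tx)
    ... | inj₁ p∣t = contradiction p∣t p∤t
    ... | inj₂ (divides x′ refl) = subst (p ^ suc R ∣_) (*-comm p x′)
      (*-monoʳ-∣ p (p∤t⇒p^R∣t*x⇒p^R∣x R p∤t (*-cancelˡ-∣ p (subst (p ^ suc R ∣_) (swap t x′ p) p^[1+R]∣tx))))
      where
      swap : ∀ t x′ p → t * (x′ * p) ≡ p * (t * x′)
      swap = solve-∀

    -- Induction on R: if p ∤ t then t cancels; otherwise p ∣ y as well, and a factor p cancels from t and y.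
    p^R∣t*x⇒p^R∣x*y : ∀ R {t x y} → p ^ R ∣ t * x → (∀ a → p ^ a ∣ t → p ^ a ∣ y) → p ^ R ∣ x * y
    p^R∣t*x⇒p^R∣x*y zero    {x = x} {y} _ _ = 1∣ (x * y)
    p^R∣t*x⇒p^R∣x*y (suc R) {t} {x} {y} p^[1+R]∣tx p^a∣t⇒p^a∣y with p ∣? t
    ... | no p∤t = ∣m⇒∣m*n y (p∤t⇒p^R∣t*x⇒p^R∣x (suc R) p∤t p^[1+R]∣tx)
    ... | yes (divides t′ refl) with p^a∣t⇒p^a∣y 1 (subst (_∣ t′ * p) (sym (*-identityʳ p)) (n∣m*n t′))
    ...   | divides y′ refl = subst (p ^ suc R ∣_) (p[xy′]≡x[y′p¹] p x y′)
              (*-monoʳ-∣ p (p^R∣t*x⇒p^R∣x*y R p^R∣t′x p^a∣t′⇒p^a∣y′))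
      where
      p[xy′]≡x[y′p¹] : ∀ p x y′ → p * (x * y′) ≡ x * (y′ * (p * 1))
      p[xy′]≡x[y′p¹] = solve-∀
      t′px≡p[t′x] : ∀ p t′ x → t′ * p * x ≡ p * (t′ * x)
      t′px≡p[t′x] = solve-∀
      y′p¹≡py′ : ∀ p y′ → y′ * (p * 1) ≡ p * y′
      y′p¹≡py′ = solve-∀
      p^R∣t′x : p ^ R ∣ t′ * x
      p^R∣t′x = *-cancelˡ-∣ p (subst (p ^ suc R ∣_) (t′px≡p[t′x] p t′ x) p^[1+R]∣tx)
      p^a∣t′⇒p^a∣y′ : ∀ a → p ^ a ∣ t′ → p ^ a ∣ y′
      p^a∣t′⇒p^a∣y′ a p^a∣t′ = *-cancelˡ-∣ p (subst (p ^ suc a ∣_) (y′p¹≡py′ p y′)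
        (p^a∣t⇒p^a∣y (suc a) (subst (p ^ suc a ∣_) (*-comm p t′) (*-monoʳ-∣ p p^a∣t′))))

    p^R∣d⇒p^R∣dC[1+k]*y : ∀ R {d k y} → p ^ R ∣ d → (∀ a → p ^ a ∣ suc k → p ^ a ∣ y) →
                          p ^ R ∣ (d C suc k) * y
    p^R∣d⇒p^R∣dC[1+k]*y R {zero}  _ _ = (p ^ R) ∣0
    p^R∣d⇒p^R∣dC[1+k]*y R {suc n} {k} p^R∣d p^a∣[1+k]⇒p^a∣y = p^R∣t*x⇒p^R∣x*y R
      (subst (p ^ R ∣_) (sym ([1+k]*[1+n]C[1+k]≡[1+n]*nCk n k)) (∣m⇒∣m*n (n C k) p^R∣d))
      p^a∣[1+k]⇒p^a∣y

open BinomialValuation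

open import Algebra.Bundles using (CommutativeSemigroup)
open import Data.Fin as Fin using (Fin; toℕ)
open import Data.Integer as ℤ using (ℤ; +_; -_; _+_; _*_; _-_; 0ℤ; 1ℤ; -1ℤ)
open import Data.Integer.DivMod using (_%ℕ_; _/ℕ_; n%ℕd<d; a≡a%ℕn+[a/ℕn]*n)
import Data.Integer.Divisibility as ℤᵘ
open import Data.Integer.Divisibility.Signed
  using (_∣_; divides; ∣ᵤ⇒∣; ∣⇒∣ᵤ; ∣-refl; ∣-trans; ∣m⇒∣-m; ∣m∣n⇒∣m+n; ∣m∣n⇒∣m-n;
         ∣m⇒∣m*n; ∣n⇒∣m*n; *-monoʳ-∣; *-monoˡ-∣; *-cancelˡ-∣)
import Data.Integer.Properties as ℤₚ
open import Data.Integer.Tactic.RingSolver using (solve-∀)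
open import Data.Nat as ℕ using (ℕ; zero; suc; _∸_; _≤_; _<_; _≥_; _^_; z≤n; s≤s)
open import Data.Nat.Combinatorics using (_C_; nCn≡1; k>n⇒nCk≡0; nCk+nC[k+1]≡[n+1]C[k+1])
open import Data.Nat.Divisibility using (_∣?_)
import Data.Nat.Divisibility as ℕ∣
open import Data.Nat.Induction using (<-rec)
open import Data.Nat.Primality using (Prime; prime?; prime[2])
import Data.Nat.Properties as ℕₚ
open import Data.Product using (∃; _×_; _,_)
open import Data.Sum using (_⊎_; inj₁; inj₂)
open import Data.Vec using (Vec; []; _∷_; _∷ʳ_; lookup)
open import Level using (0ℓ)
open import Relation.Binary.Bundles using (Setoid)
import Relation.Binary.Reasoning.Setoid as SetoidReasoning
open import Relation.Nullary using (yes; no; contradiction)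
open import Relation.Nullary.Decidable using (from-yes; from-no)

sum : ℕ → (ℕ → ℤ) → ℤ
sum zero    f = 0ℤ
sum (suc n) f = f 0 + sum n (λ k → f (suc k))

sum-cong : ∀ n {f g : ℕ → ℤ} → (∀ k → k < n → f k ≡ g k) → sum n f ≡ sum n g
sum-cong zero    f≡g = refl
sum-cong (suc n) f≡g = cong₂ _+_ (f≡g 0 (s≤s z≤n)) (sum-cong n (λ k k<n → f≡g (suc k) (s≤s k<n)))

sum-+ : ∀ n (f g : ℕ → ℤ) → sum n (λ k → f k + g k) ≡ sum n f + sum n g
sum-+ zero    f g = refl
sum-+ (suc n) f g = trans (cong (_+_ (f 0 + g 0)) (sum-+ n _ _)) (interchange (f 0) (g 0) _ _)
  where
  interchange : ∀ a b c d → (a + b) + (c + d) ≡ (a + c) + (b + d)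
  interchange = solve-∀

*-distribˡ-sum : ∀ n c (f : ℕ → ℤ) → sum n (λ k → c * f k) ≡ c * sum n f
*-distribˡ-sum zero    c f = sym (ℤₚ.*-zeroʳ c)
*-distribˡ-sum (suc n) c f =
  trans (cong (_+_ (c * f 0)) (*-distribˡ-sum n c _)) (sym (ℤₚ.*-distribˡ-+ c (f 0) _))

sum-init-last : ∀ n (f : ℕ → ℤ) → sum (suc n) f ≡ sum n f + f n
sum-init-last zero    f = ℤₚ.+-comm (f 0) 0ℤ
sum-init-last (suc n) f = trans (cong (_+_ (f 0)) (sum-init-last n _)) (sym (ℤₚ.+-assoc (f 0) _ _))

∣-sum : ∀ n {q} (f : ℕ → ℤ) → (∀ k → k < n → q ∣ f k) → q ∣ sum n f
∣-sum zero    f q∣f = divides 0ℤ refl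
∣-sum (suc n) f q∣f = ∣m∣n⇒∣m+n (q∣f 0 (s≤s z≤n)) (∣-sum n _ (λ k k<n → q∣f (suc k) (s≤s k<n)))

binsum : ℕ → (ℕ → ℕ → ℤ) → ℤ
binsum n F = sum (suc n) (λ k → + (n C k) * F k (n ∸ k))

binsum-cong : ∀ n {F G : ℕ → ℕ → ℤ} → (∀ k → k ≤ n → F k (n ∸ k) ≡ G k (n ∸ k)) → binsum n F ≡ binsum n G
binsum-cong n F≡G = sum-cong (suc n) (λ k k<1+n → cong (+ (n C k) *_) (F≡G k (ℕₚ.≤-pred k<1+n)))

binsum-+ : ∀ n (F G : ℕ → ℕ → ℤ) → binsum n (λ i j → F i j + G i j) ≡ binsum n F + binsum n G
binsum-+ n F G = trans
  (sum-cong (suc n) (λ k _ → ℤₚ.*-distribˡ-+ (+ (n C k)) (F k (n ∸ k)) (G k (n ∸ k))))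
  (sum-+ (suc n) (λ k → + (n C k) * F k (n ∸ k)) (λ k → + (n C k) * G k (n ∸ k)))

*-distribˡ-binsum : ∀ n c (F : ℕ → ℕ → ℤ) → binsum n (λ i j → c * F i j) ≡ c * binsum n F
*-distribˡ-binsum n c F = trans
  (sum-cong (suc n) (λ k _ → *-swapˡ (+ (n C k)) c (F k (n ∸ k))))
  (*-distribˡ-sum (suc n) c (λ k → + (n C k) * F k (n ∸ k)))
  where
  *-swapˡ : ∀ x y z → x * (y * z) ≡ y * (x * z)
  *-swapˡ = solve-∀

∣-binsum : ∀ n {q} (F : ℕ → ℕ → ℤ) → (∀ k → k ≤ n → q ∣ F k (n ∸ k)) → q ∣ binsum n F
∣-binsum n F q∣F = ∣-sum (suc n) _ (λ k k<1+n → ∣n⇒∣m*n (+ (n C k)) (q∣F k (ℕₚ.≤-pred k<1+n)))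

binsum-suc : ∀ n F → binsum (suc n) F ≡ binsum n (λ i j → F (suc i) j) + binsum n (λ i j → F i (suc j))
binsum-suc n F = begin
  binsum (suc n) F
    ≡⟨⟩
  + 1 * F 0 (suc n) + sum (suc n) (λ k → + (suc n C suc k) * F (suc k) (n ∸ k))
    ≡⟨ cong (_+_ (+ 1 * F 0 (suc n)))
         (trans (sum-cong (suc n) (λ k _ → pascal k)) (sum-+ (suc n) (λ k → + (n C k) * F (suc k) (n ∸ k)) G)) ⟩
  + 1 * F 0 (suc n) + (binsum n (λ i j → F (suc i) j) + sum (suc n) G)
    ≡⟨ cong (λ s → + 1 * F 0 (suc n) + (binsum n (λ i j → F (suc i) j) + s)) (sum-init-last n G) ⟩
  + 1 * F 0 (suc n) + (binsum n (λ i j → F (suc i) j) + (sum n G + G n))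
    ≡⟨ cong (λ g → + 1 * F 0 (suc n) + (binsum n (λ i j → F (suc i) j) + (sum n G + g))) G[n]≡0 ⟩
  + 1 * F 0 (suc n) + (binsum n (λ i j → F (suc i) j) + (sum n G + 0ℤ))
    ≡⟨ rearrange (F 0 (suc n)) (binsum n (λ i j → F (suc i) j)) (sum n G) ⟩
  binsum n (λ i j → F (suc i) j) + (+ 1 * F 0 (suc n) + sum n G)
    ≡⟨ cong (λ s → binsum n (λ i j → F (suc i) j) + (+ 1 * F 0 (suc n) + s))
         (sum-cong n (λ k k<n → cong (λ j → + (n C suc k) * F (suc k) j) (ℕₚ.+-∸-assoc 1 k<n))) ⟩
  binsum n (λ i j → F (suc i) j) + binsum n (λ i j → F i (suc j))
    ∎
  where
  open ≡-Reasoning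
  G : ℕ → ℤ
  G k = + (n C suc k) * F (suc k) (n ∸ k)
  pascal : ∀ k → + (suc n C suc k) * F (suc k) (n ∸ k) ≡ + (n C k) * F (suc k) (n ∸ k) + G k
  pascal k = begin
    + (suc n C suc k) * F (suc k) (n ∸ k)
      ≡⟨ cong (λ c → + c * F (suc k) (n ∸ k)) (nCk+nC[k+1]≡[n+1]C[k+1] n k) ⟨
    + (n C k ℕ.+ n C suc k) * F (suc k) (n ∸ k)
      ≡⟨ cong (_* F (suc k) (n ∸ k)) (ℤₚ.pos-+ (n C k) (n C suc k)) ⟩
    (+ (n C k) + + (n C suc k)) * F (suc k) (n ∸ k)
      ≡⟨ ℤₚ.*-distribʳ-+ (F (suc k) (n ∸ k)) (+ (n C k)) (+ (n C suc k)) ⟩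
    + (n C k) * F (suc k) (n ∸ k) + G k
      ∎
  G[n]≡0 : G n ≡ 0ℤ
  G[n]≡0 = cong (λ c → + c * F (suc n) (n ∸ n)) (k>n⇒nCk≡0 (ℕₚ.n<1+n n))
  rearrange : ∀ a x y → + 1 * a + (x + (y + 0ℤ)) ≡ x + (+ 1 * a + y)
  rearrange = solve-∀

-- A sequence a stands for the series Σ a n zⁿ/n!: _⋆_ is the product of series, ∂ and ∂^ t are
-- differentiation, δ is the series 1, ex o is e^{oz} and reflect a is a(-z).
Seq : Set
Seq = ℕ → ℤ

infixl 6 _⊕_ _⊖_
infixr 7 _·_
infixl 7 _⋆_

_⊕_ : Seq → Seq → Seq
(a ⊕ b) k = a k + b k

_⊖_ : Seq → Seq → Seq
(a ⊖ b) k = a k - b k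

_·_ : ℤ → Seq → Seq
(c · a) k = c * a k

𝟎 : Seq
𝟎 _ = 0ℤ

δ : Seq
δ zero    = 1ℤ
δ (suc _) = 0ℤ

∂ : Seq → Seq
∂ a k = a (suc k)

∂^ : ℕ → Seq → Seq
∂^ t a k = a (t ℕ.+ k)

ex : ℤ → Seq
ex o m = o ℤ.^ m

_⋆_ : Seq → Seq → Seq
(a ⋆ b) m = binsum m (λ i j → a i * b j)

·-congʳ : ∀ c {a b} → a ≗ b → c · a ≗ c · b
·-congʳ c a≗b m = cong (c *_) (a≗b m)

≗-sym : ∀ {a b : Seq} → a ≗ b → b ≗ a
≗-sym a≗b m = sym (a≗b m)

module ≗-Reasoning = SetoidReasoning (ℕ →-setoid ℤ)

⋆-head : ∀ a b → (a ⋆ b) 0 ≡ a 0 * b 0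
⋆-head a b = trans (ℤₚ.+-identityʳ _) (ℤₚ.*-identityˡ _)

⋆-suc : ∀ a b m → (a ⋆ b) (suc m) ≡ (∂ a ⋆ b) m + (a ⋆ ∂ b) m
⋆-suc a b m = binsum-suc m (λ i j → a i * b j)

⋆-cong : ∀ {a a′ b b′} → a ≗ a′ → b ≗ b′ → a ⋆ b ≗ a′ ⋆ b′
⋆-cong {a} {a′} {b} {b′} a≗a′ b≗b′ m =
  binsum-cong m {λ i j → a i * b j} {λ i j → a′ i * b′ j} (λ i _ → cong₂ _*_ (a≗a′ i) (b≗b′ (m ∸ i)))

⋆-congˡ : ∀ {a a′} b → a ≗ a′ → a ⋆ b ≗ a′ ⋆ b
⋆-congˡ b a≗a′ = ⋆-cong a≗a′ (λ _ → refl)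

⋆-congʳ : ∀ a {b b′} → b ≗ b′ → a ⋆ b ≗ a ⋆ b′
⋆-congʳ a = ⋆-cong {a} (λ _ → refl)

⋆-comm : ∀ a b → a ⋆ b ≗ b ⋆ a
⋆-comm a b zero    = trans (⋆-head a b) (trans (ℤₚ.*-comm (a 0) (b 0)) (sym (⋆-head b a)))
⋆-comm a b (suc m) = begin
  (a ⋆ b) (suc m)                ≡⟨ ⋆-suc a b m ⟩
  (∂ a ⋆ b) m + (a ⋆ ∂ b) m      ≡⟨ cong₂ _+_ (⋆-comm (∂ a) b m) (⋆-comm a (∂ b) m) ⟩
  (b ⋆ ∂ a) m + (∂ b ⋆ a) m      ≡⟨ ℤₚ.+-comm ((b ⋆ ∂ a) m) ((∂ b ⋆ a) m) ⟩
  (∂ b ⋆ a) m + (b ⋆ ∂ a) m      ≡⟨ ⋆-suc b a m ⟨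
  (b ⋆ a) (suc m)                ∎
  where open ≡-Reasoning

⋆-distribˡ-⊕ : ∀ a b c → a ⋆ (b ⊕ c) ≗ a ⋆ b ⊕ a ⋆ c
⋆-distribˡ-⊕ a b c m = trans
  (binsum-cong m {λ i j → a i * (b j + c j)} {λ i j → a i * b j + a i * c j}
    (λ i _ → ℤₚ.*-distribˡ-+ (a i) (b (m ∸ i)) (c (m ∸ i))))
  (binsum-+ m (λ i j → a i * b j) (λ i j → a i * c j))

⋆-distribʳ-⊕ : ∀ a b c → (b ⊕ c) ⋆ a ≗ b ⋆ a ⊕ c ⋆ a
⋆-distribʳ-⊕ a b c m = trans (⋆-comm (b ⊕ c) a m)
  (trans (⋆-distribˡ-⊕ a b c m) (cong₂ _+_ (⋆-comm a b m) (⋆-comm a c m)))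

⋆-· : ∀ c a b → a ⋆ (c · b) ≗ c · (a ⋆ b)
⋆-· c a b m = trans
  (binsum-cong m {λ i j → a i * (c * b j)} {λ i j → c * (a i * b j)} (λ i _ → *-swapˡ (a i) c (b (m ∸ i))))
  (*-distribˡ-binsum m c (λ i j → a i * b j))
  where
  *-swapˡ : ∀ x y z → x * (y * z) ≡ y * (x * z)
  *-swapˡ = solve-∀

·-⋆ : ∀ c a b → (c · a) ⋆ b ≗ c · (a ⋆ b)
·-⋆ c a b m = trans (⋆-comm (c · a) b m) (trans (⋆-· c b a m) (cong (c *_) (⋆-comm b a m)))

⋆-zeroʳ : ∀ a → a ⋆ 𝟎 ≗ 𝟎
⋆-zeroʳ a = ⋆-· 0ℤ a 𝟎

⋆-identityʳ : ∀ a → a ⋆ δ ≗ a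
⋆-identityʳ a zero    = trans (⋆-head a δ) (ℤₚ.*-identityʳ (a 0))
⋆-identityʳ a (suc m) = begin
  (a ⋆ δ) (suc m)               ≡⟨ ⋆-suc a δ m ⟩
  (∂ a ⋆ δ) m + (a ⋆ 𝟎) m       ≡⟨ cong₂ _+_ (⋆-identityʳ (∂ a) m) (⋆-zeroʳ a m) ⟩
  a (suc m) + 0ℤ                ≡⟨ ℤₚ.+-identityʳ (a (suc m)) ⟩
  a (suc m)                     ∎
  where open ≡-Reasoning

⋆-identityˡ : ∀ a → δ ⋆ a ≗ a
⋆-identityˡ a m = trans (⋆-comm δ a m) (⋆-identityʳ a m)

⋆-assoc : ∀ a b c → (a ⋆ b) ⋆ c ≗ a ⋆ (b ⋆ c)
⋆-assoc a b c zero = begin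
  ((a ⋆ b) ⋆ c) 0          ≡⟨ ⋆-head (a ⋆ b) c ⟩
  (a ⋆ b) 0 * c 0          ≡⟨ cong (_* c 0) (⋆-head a b) ⟩
  a 0 * b 0 * c 0          ≡⟨ ℤₚ.*-assoc (a 0) (b 0) (c 0) ⟩
  a 0 * (b 0 * c 0)        ≡⟨ cong (a 0 *_) (⋆-head b c) ⟨
  a 0 * (b ⋆ c) 0          ≡⟨ ⋆-head a (b ⋆ c) ⟨
  (a ⋆ (b ⋆ c)) 0          ∎
  where open ≡-Reasoning
⋆-assoc a b c (suc m) = begin
  ((a ⋆ b) ⋆ c) (suc m)
    ≡⟨ ⋆-suc (a ⋆ b) c m ⟩
  (∂ (a ⋆ b) ⋆ c) m + ((a ⋆ b) ⋆ ∂ c) m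
    ≡⟨ cong (_+ ((a ⋆ b) ⋆ ∂ c) m)
         (trans (⋆-congˡ c (⋆-suc a b) m) (⋆-distribʳ-⊕ c (∂ a ⋆ b) (a ⋆ ∂ b) m)) ⟩
  ((∂ a ⋆ b) ⋆ c) m + ((a ⋆ ∂ b) ⋆ c) m + ((a ⋆ b) ⋆ ∂ c) m
    ≡⟨ cong₂ _+_ (cong₂ _+_ (⋆-assoc (∂ a) b c m) (⋆-assoc a (∂ b) c m)) (⋆-assoc a b (∂ c) m) ⟩
  (∂ a ⋆ (b ⋆ c)) m + (a ⋆ (∂ b ⋆ c)) m + (a ⋆ (b ⋆ ∂ c)) m
    ≡⟨ ℤₚ.+-assoc ((∂ a ⋆ (b ⋆ c)) m) ((a ⋆ (∂ b ⋆ c)) m) ((a ⋆ (b ⋆ ∂ c)) m) ⟩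
  (∂ a ⋆ (b ⋆ c)) m + ((a ⋆ (∂ b ⋆ c)) m + (a ⋆ (b ⋆ ∂ c)) m)
    ≡⟨ cong (_+_ ((∂ a ⋆ (b ⋆ c)) m))
         (trans (⋆-congʳ a (⋆-suc b c) m) (⋆-distribˡ-⊕ a (∂ b ⋆ c) (b ⋆ ∂ c) m)) ⟨
  (∂ a ⋆ (b ⋆ c)) m + (a ⋆ ∂ (b ⋆ c)) m
    ≡⟨ ⋆-suc a (b ⋆ c) m ⟨
  (a ⋆ (b ⋆ c)) (suc m)
    ∎
  where open ≡-Reasoning

⋆-commutativeSemigroup : CommutativeSemigroup 0ℓ 0ℓ
⋆-commutativeSemigroup = record
  { Carrier = Seq
  ; _≈_ = _≗_
  ; _∙_ = _⋆_
  ; isCommutativeSemigroup = record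
    { isSemigroup = record
      { isMagma = record { isEquivalence = Setoid.isEquivalence (ℕ →-setoid ℤ) ; ∙-cong = ⋆-cong }
      ; assoc = ⋆-assoc
      }
    ; comm = ⋆-comm
    }
  }

open import Algebra.Properties.CommutativeSemigroup ⋆-commutativeSemigroup
  using (x∙yz≈y∙xz; x∙yz≈xz∙y; xy∙z≈xz∙y)

⋆-distribˡ-⊖ : ∀ a b c → a ⋆ (b ⊖ c) ≗ a ⋆ b ⊖ a ⋆ c
⋆-distribˡ-⊖ a b c m = begin
  (a ⋆ (b ⊖ c)) m                 ≡⟨ ⋆-congʳ a (λ k → sub≡add-neg (b k) (c k)) m ⟩
  (a ⋆ (b ⊕ -1ℤ · c)) m           ≡⟨ ⋆-distribˡ-⊕ a b (-1ℤ · c) m ⟩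
  (a ⋆ b) m + (a ⋆ (-1ℤ · c)) m   ≡⟨ cong (_+_ ((a ⋆ b) m)) (⋆-· -1ℤ a c m) ⟩
  (a ⋆ b) m + -1ℤ * (a ⋆ c) m     ≡⟨ sub≡add-neg ((a ⋆ b) m) ((a ⋆ c) m) ⟨
  (a ⋆ b) m - (a ⋆ c) m           ∎
  where
  open ≡-Reasoning
  sub≡add-neg : ∀ x y → x - y ≡ x + -1ℤ * y
  sub≡add-neg = solve-∀

⋆-distribʳ-⊖ : ∀ a b c → (b ⊖ c) ⋆ a ≗ b ⋆ a ⊖ c ⋆ a
⋆-distribʳ-⊖ a b c m = trans (⋆-comm (b ⊖ c) a m)
  (trans (⋆-distribˡ-⊖ a b c m) (cong₂ _-_ (⋆-comm a b m) (⋆-comm a c m)))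

∣-⋆ʳ : ∀ {q} a b → (∀ j → q ∣ b j) → ∀ m → q ∣ (a ⋆ b) m
∣-⋆ʳ a b q∣b m = ∣-binsum m (λ i j → a i * b j) (λ k _ → ∣n⇒∣m*n (a k) (q∣b (m ∸ k)))

∣[V⊖c·δ]⇒∣[a⋆V]-c*a : ∀ {q} a V c → (∀ j → q ∣ (V ⊖ c · δ) j) → ∀ m → q ∣ (a ⋆ V) m - c * a m
∣[V⊖c·δ]⇒∣[a⋆V]-c*a {q} a V c q∣V-cδ m = subst (q ∣_)
  (trans (⋆-distribˡ-⊖ a V (c · δ) m) (cong (_-_ ((a ⋆ V) m)) (trans (⋆-· c a δ m) (cong (c *_) (⋆-identityʳ a m)))))
  (∣-⋆ʳ a (V ⊖ c · δ) q∣V-cδ m)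

ex-⋆-ex : ∀ x y → ex x ⋆ ex y ≗ ex (x + y)
ex-⋆-ex x y zero    = refl
ex-⋆-ex x y (suc m) = begin
  (ex x ⋆ ex y) (suc m)                           ≡⟨ ⋆-suc (ex x) (ex y) m ⟩
  ((x · ex x) ⋆ ex y) m + (ex x ⋆ (y · ex y)) m   ≡⟨ cong₂ _+_ (·-⋆ x (ex x) (ex y) m) (⋆-· y (ex x) (ex y) m) ⟩
  x * (ex x ⋆ ex y) m + y * (ex x ⋆ ex y) m       ≡⟨ ℤₚ.*-distribʳ-+ ((ex x ⋆ ex y) m) x y ⟨
  (x + y) * (ex x ⋆ ex y) m                       ≡⟨ cong ((x + y) *_) (ex-⋆-ex x y m) ⟩
  (x + y) ℤ.^ suc m                               ∎
  where open ≡-Reasoning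

⋆-leibniz : ∀ n a b m → (a ⋆ b) (n ℕ.+ m) ≡ binsum n (λ i j → (∂^ j a ⋆ ∂^ i b) m)
⋆-leibniz zero    a b m = sym (trans (ℤₚ.+-identityʳ _) (ℤₚ.*-identityˡ _))
⋆-leibniz (suc n) a b m = begin
  (a ⋆ b) (suc (n ℕ.+ m))
    ≡⟨ ⋆-suc a b (n ℕ.+ m) ⟩
  (∂ a ⋆ b) (n ℕ.+ m) + (a ⋆ ∂ b) (n ℕ.+ m)
    ≡⟨ cong₂ _+_ (⋆-leibniz n (∂ a) b m) (⋆-leibniz n a (∂ b) m) ⟩
  binsum n (λ i j → (∂^ (suc j) a ⋆ ∂^ i b) m) + binsum n (λ i j → (∂^ j a ⋆ ∂^ (suc i) b) m)
    ≡⟨ ℤₚ.+-comm (binsum n (λ i j → (∂^ (suc j) a ⋆ ∂^ i b) m)) _ ⟩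
  binsum n (λ i j → (∂^ j a ⋆ ∂^ (suc i) b) m) + binsum n (λ i j → (∂^ (suc j) a ⋆ ∂^ i b) m)
    ≡⟨ binsum-suc n (λ i j → (∂^ j a ⋆ ∂^ i b) m) ⟨
  binsum (suc n) (λ i j → (∂^ j a ⋆ ∂^ i b) m)
    ∎
  where open ≡-Reasoning

reflect : Seq → Seq
reflect a m = -1ℤ ℤ.^ m * a m

reflect-⋆ : ∀ a b → reflect (a ⋆ b) ≗ reflect a ⋆ reflect b
reflect-⋆ a b m = trans (sym (*-distribˡ-binsum m (-1ℤ ℤ.^ m) (λ i j → a i * b j)))
  (binsum-cong m {λ i j → -1ℤ ℤ.^ m * (a i * b j)} {λ i j → reflect a i * reflect b j} split-sign)
  where
  interchange : ∀ s t x y → (s * t) * (x * y) ≡ (s * x) * (t * y)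
  interchange = solve-∀
  split-sign : ∀ k → k ≤ m → -1ℤ ℤ.^ m * (a k * b (m ∸ k)) ≡ reflect a k * reflect b (m ∸ k)
  split-sign k k≤m = begin
    -1ℤ ℤ.^ m * (a k * b (m ∸ k))
      ≡⟨ cong (λ n → -1ℤ ℤ.^ n * (a k * b (m ∸ k))) (ℕₚ.m+[n∸m]≡n k≤m) ⟨
    -1ℤ ℤ.^ (k ℕ.+ (m ∸ k)) * (a k * b (m ∸ k))
      ≡⟨ cong (_* (a k * b (m ∸ k))) (ℤₚ.^-distribˡ-+-* -1ℤ k (m ∸ k)) ⟩
    (-1ℤ ℤ.^ k * -1ℤ ℤ.^ (m ∸ k)) * (a k * b (m ∸ k))
      ≡⟨ interchange (-1ℤ ℤ.^ k) (-1ℤ ℤ.^ (m ∸ k)) (a k) (b (m ∸ k)) ⟩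
    reflect a k * reflect b (m ∸ k)
      ∎
    where open ≡-Reasoning

reflect-δ : reflect δ ≗ δ
reflect-δ zero    = refl
reflect-δ (suc m) = ℤₚ.*-zeroʳ (-1ℤ ℤ.^ suc m)

reflect-ex : ∀ o → reflect (ex o) ≗ ex (- o)
reflect-ex o zero    = refl
reflect-ex o (suc m) = trans (interchange (-1ℤ ℤ.^ m) (o ℤ.^ m) o) (cong (- o *_) (reflect-ex o m))
  where
  interchange : ∀ s t o → (-1ℤ * s) * (o * t) ≡ - o * (s * t)
  interchange = solve-∀

infixr 8 _⋆^_
_⋆^_ : Seq → ℕ → Seq
a ⋆^ zero  = δ
a ⋆^ suc n = a ⋆ a ⋆^ n

⋆^-+ : ∀ a m n → a ⋆^ (m ℕ.+ n) ≗ a ⋆^ m ⋆ a ⋆^ n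
⋆^-+ a zero    n k = sym (⋆-identityˡ (a ⋆^ n) k)
⋆^-+ a (suc m) n k = trans (⋆-congʳ a (⋆^-+ a m n) k) (sym (⋆-assoc a (a ⋆^ m) (a ⋆^ n) k))

⋆^-head : ∀ a n → (a ⋆^ n) 0 ≡ a 0 ℤ.^ n
⋆^-head a zero    = refl
⋆^-head a (suc n) = trans (⋆-head a (a ⋆^ n)) (cong (a 0 *_) (⋆^-head a n))

⋆-cube-suc : ∀ a m → (a ⋆ (a ⋆ a)) (suc m) ≡ + 3 * (a ⋆ (a ⋆ ∂ a)) m
⋆-cube-suc a m = begin
  (a ⋆ (a ⋆ a)) (suc m)                       ≡⟨ ⋆-suc a (a ⋆ a) m ⟩
  (∂ a ⋆ (a ⋆ a)) m + (a ⋆ ∂ (a ⋆ a)) m       ≡⟨ cong₂ _+_ ∂a⋆[a⋆a] (⋆-congʳ a (⋆-suc a a) m) ⟩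
  A + (a ⋆ (∂ a ⋆ a ⊕ a ⋆ ∂ a)) m             ≡⟨ cong (_+_ A) (⋆-distribˡ-⊕ a (∂ a ⋆ a) (a ⋆ ∂ a) m) ⟩
  A + ((a ⋆ (∂ a ⋆ a)) m + A)                 ≡⟨ cong (λ x → A + (x + A)) (⋆-congʳ a (⋆-comm (∂ a) a) m) ⟩
  A + (A + A)                                 ≡⟨ triple A ⟩
  + 3 * A                                     ∎
  where
  open ≡-Reasoning
  A = (a ⋆ (a ⋆ ∂ a)) m
  ∂a⋆[a⋆a] : (∂ a ⋆ (a ⋆ a)) m ≡ A
  ∂a⋆[a⋆a] = trans (⋆-comm (∂ a) (a ⋆ a) m) (⋆-assoc a a (∂ a) m)
  triple : ∀ x → x + (x + x) ≡ + 3 * x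
  triple = solve-∀

3^k∣[a⋆^3^k]-suc : ∀ a k m → + (3 ^ k) ∣ (a ⋆^ 3 ^ k) (suc m)
3^k∣[a⋆^3^k]-suc a zero    m = divides ((a ⋆^ 1) (suc m)) (sym (ℤₚ.*-identityʳ _))
3^k∣[a⋆^3^k]-suc a (suc k) m = subst (+ (3 ^ suc k) ∣_) (sym (trans (cube (suc m)) (⋆-cube-suc Q m)))
  (subst (_∣ + 3 * (Q ⋆ (Q ⋆ ∂ Q)) m) (sym (ℤₚ.pos-* 3 (3 ^ k)))
    (*-monoʳ-∣ (+ 3) (∣-⋆ʳ Q (Q ⋆ ∂ Q) (∣-⋆ʳ Q (∂ Q) (3^k∣[a⋆^3^k]-suc a k)) m)))
  where
  Q = a ⋆^ 3 ^ k
  cube : a ⋆^ 3 ^ suc k ≗ Q ⋆ (Q ⋆ Q)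
  cube n = begin
    (a ⋆^ (3 ^ k ℕ.+ (3 ^ k ℕ.+ (3 ^ k ℕ.+ 0)))) n   ≡⟨ ⋆^-+ a (3 ^ k) _ n ⟩
    (Q ⋆ a ⋆^ (3 ^ k ℕ.+ (3 ^ k ℕ.+ 0))) n           ≡⟨ ⋆-congʳ Q (⋆^-+ a (3 ^ k) _) n ⟩
    (Q ⋆ (Q ⋆ a ⋆^ (3 ^ k ℕ.+ 0))) n
      ≡⟨ ⋆-congʳ Q (⋆-congʳ Q (λ i → cong (λ j → (a ⋆^ j) i) (ℕₚ.+-identityʳ (3 ^ k)))) n ⟩
    (Q ⋆ (Q ⋆ Q)) n                                   ∎
    where open ≡-Reasoning

χ : ℕ → Seq
χ N j with N ∣? j
... | yes _ = 1ℤ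
... | no  _ = 0ℤ

χ-head : ∀ N → χ N 0 ≡ 1ℤ
χ-head N with N ∣? 0
... | yes _   = refl
... | no  N∤0 = contradiction (N ℕ∣.∣0) N∤0

χ-periodic : ∀ N → ∂^ N (χ N) ≗ χ N
χ-periodic N k with N ∣? (N ℕ.+ k) | N ∣? k
... | yes _     | yes _ = refl
... | no  _     | no  _ = refl
... | yes N∣N+k | no N∤k = contradiction (ℕ∣.∣m+n∣m⇒∣n N∣N+k ℕ∣.∣-refl) N∤k
... | no N∤N+k  | yes N∣k = contradiction (ℕ∣.∣m∣n⇒∣m+n ℕ∣.∣-refl N∣k) N∤N+k

term≡ : ∀ N n k x → term N n k x ≡ + (n C k) * (x * χ N (n ∸ k))
term≡ N n k x with N ∣? (n ∸ k)
... | yes _ = cong (+ (n C k) *_) (sym (ℤₚ.*-identityʳ x))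
... | no  _ = sym (trans (cong (+ (n C k) *_) (ℤₚ.*-zeroʳ x)) (ℤₚ.*-zeroʳ (+ (n C k))))

lookup-∷ʳ : ∀ {n} (xs : Vec ℤ n) y (f : ℕ → ℤ) →
            (∀ i → lookup xs i ≡ f (toℕ i)) → y ≡ f n → ∀ i → lookup (xs ∷ʳ y) i ≡ f (toℕ i)
lookup-∷ʳ []       y f _     y≡fn Fin.zero    = y≡fn
lookup-∷ʳ (x ∷ xs) y f xs≡f _    Fin.zero    = xs≡f Fin.zero
lookup-∷ʳ (x ∷ xs) y f xs≡f y≡fn (Fin.suc i) =
  lookup-∷ʳ xs y (λ k → f (suc k)) (λ k → xs≡f (Fin.suc k)) y≡fn i

lookup-hist : ∀ N n (i : Fin n) → lookup (hist N n) i ≡ 𝓔 N (toℕ i)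
lookup-hist N (suc n) = lookup-∷ʳ (hist N n) (𝓔 N n) (𝓔 N) (lookup-hist N n) refl

sumFin≡sum : ∀ n (f : Fin n → ℤ) (g : ℕ → ℤ) → (∀ i → f i ≡ g (toℕ i)) → sumFin f ≡ sum n g
sumFin≡sum zero    f g f≡g = refl
sumFin≡sum (suc n) f g f≡g =
  cong₂ _+_ (f≡g Fin.zero) (sumFin≡sum n (λ i → f (Fin.suc i)) (λ k → g (suc k)) (λ i → f≡g (Fin.suc i)))

𝓔-suc : ∀ N n → 𝓔 N (suc n) ≡ - sum (suc n) (λ k → + (suc n C k) * (𝓔 N k * χ N (suc n ∸ k)))
𝓔-suc N n = cong -_ (sumFin≡sum (suc n) _ (λ k → + (suc n C k) * (𝓔 N k * χ N (suc n ∸ k))) (λ i →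
  trans (cong (term N (suc n) (toℕ i)) (lookup-hist N (suc n) i)) (term≡ N (suc n) (toℕ i) (𝓔 N (toℕ i)))))

𝓔⋆χ≗δ : ∀ N → 𝓔 N ⋆ χ N ≗ δ
𝓔⋆χ≗δ N zero    = trans (⋆-head (𝓔 N) (χ N)) (cong (1ℤ *_) (χ-head N))
𝓔⋆χ≗δ N (suc n) = begin
  (𝓔 N ⋆ χ N) (suc n)          ≡⟨ sum-init-last (suc n) f ⟩
  sum (suc n) f + f (suc n)     ≡⟨ cong (_+_ (sum (suc n) f)) f[1+n]≡𝓔[1+n] ⟩
  sum (suc n) f + 𝓔 N (suc n)   ≡⟨ cong (_+_ (sum (suc n) f)) (𝓔-suc N n) ⟩
  sum (suc n) f - sum (suc n) f ≡⟨ ℤₚ.+-inverseʳ (sum (suc n) f) ⟩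
  0ℤ                            ∎
  where
  open ≡-Reasoning
  f : ℕ → ℤ
  f k = + (suc n C k) * (𝓔 N k * χ N (suc n ∸ k))
  f[1+n]≡𝓔[1+n] : f (suc n) ≡ 𝓔 N (suc n)
  f[1+n]≡𝓔[1+n] = begin
    + (suc n C suc n) * (𝓔 N (suc n) * χ N (n ∸ n))
      ≡⟨ cong (λ c → + c * (𝓔 N (suc n) * χ N (n ∸ n))) (nCn≡1 (suc n)) ⟩
    + 1 * (𝓔 N (suc n) * χ N (n ∸ n))                ≡⟨ ℤₚ.*-identityˡ _ ⟩
    𝓔 N (suc n) * χ N (n ∸ n)                        ≡⟨ cong (λ j → 𝓔 N (suc n) * χ N j) (ℕₚ.n∸n≡0 n) ⟩
    𝓔 N (suc n) * χ N 0                              ≡⟨ cong (𝓔 N (suc n) *_) (χ-head N) ⟩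
    𝓔 N (suc n) * 1ℤ                                 ≡⟨ ℤₚ.*-identityʳ (𝓔 N (suc n)) ⟩
    𝓔 N (suc n)                                      ∎

-- The terms with i ≥ 1 in the Leibniz expansion of (w ⋆ y) (d + m) all vanish modulo q.
NegligibleDerivatives : ℤ → ℕ → Seq → Set
NegligibleDerivatives q d y = ∀ k j → q ∣ + (d C suc k) * y (suc k ℕ.+ j)

Periodic : ℤ → ℕ → Seq → Set
Periodic q d a = ∀ m → q ∣ a (d ℕ.+ m) - a m

record EventuallyPeriodic (q : ℤ) (d : ℕ) (a : Seq) : Set where
  constructor periodicFrom
  field
    start    : ℕ
    periodic : ∀ m → start ≤ m → q ∣ a (d ℕ.+ m) - a m

⋆-shift-∣ : ∀ {q d y} → NegligibleDerivatives q d y → ∀ w m →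
            q ∣ ((∂^ d w ⊖ w) ⋆ y) m → q ∣ (w ⋆ y) (d ℕ.+ m) - (w ⋆ y) m
⋆-shift-∣ {q} {d} {y} negligible w m q∣head =
  subst (q ∣_) (sym split) (∣m∣n⇒∣m+n (subst (q ∣_) (⋆-distribʳ-⊖ y (∂^ d w) w m) q∣head) q∣rest)
  where
  rest : ℤ
  rest = sum d (λ k → + (d C suc k) * (∂^ (d ∸ suc k) w ⋆ ∂^ (suc k) y) m)
  q∣rest : q ∣ rest
  q∣rest = ∣-sum d _ (λ k _ → subst (q ∣_) (⋆-· (+ (d C suc k)) (∂^ (d ∸ suc k) w) (∂^ (suc k) y) m)
    (∣-⋆ʳ (∂^ (d ∸ suc k) w) _ (negligible k) m))
  regroup : ∀ a r b → (+ 1 * a + r) - b ≡ (a - b) + r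
  regroup = solve-∀
  split : (w ⋆ y) (d ℕ.+ m) - (w ⋆ y) m ≡ ((∂^ d w ⋆ y) m - (w ⋆ y) m) + rest
  split = trans (cong (_- (w ⋆ y) m) (⋆-leibniz d w y m)) (regroup ((∂^ d w ⋆ y) m) rest ((w ⋆ y) m))

periodic-fixpoint : ∀ {q d u w y} → NegligibleDerivatives q d y → y 0 ≡ 0ℤ →
                    Periodic q d u → w ≗ u ⊕ w ⋆ y → Periodic q d w
periodic-fixpoint {q} {d} {u} {w} {y} negligible y0≡0 u-periodic w≗u⊕w⋆y = <-rec _ step
  where
  regroup : ∀ a b c e → (a + b) - (c + e) ≡ (a - c) + (b - e)
  regroup = solve-∀
  step : ∀ m → (∀ {k} → k < m → q ∣ w (d ℕ.+ k) - w k) → q ∣ w (d ℕ.+ m) - w m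
  step m ih = subst (q ∣_) (sym split)
    (∣m∣n⇒∣m+n (u-periodic m)
      (⋆-shift-∣ {y = y} negligible w m (∣-binsum m (λ i j → (∂^ d w ⊖ w) i * y j) termwise)))
    where
    split : w (d ℕ.+ m) - w m ≡ (u (d ℕ.+ m) - u m) + ((w ⋆ y) (d ℕ.+ m) - (w ⋆ y) m)
    split = trans (cong₂ _-_ (w≗u⊕w⋆y (d ℕ.+ m)) (w≗u⊕w⋆y m))
      (regroup (u (d ℕ.+ m)) ((w ⋆ y) (d ℕ.+ m)) (u m) ((w ⋆ y) m))
    termwise : ∀ k → k ≤ m → q ∣ (∂^ d w ⊖ w) k * y (m ∸ k)
    termwise k k≤m with ℕₚ.m≤n⇒m<n∨m≡n k≤m
    ... | inj₁ k<m  = ∣m⇒∣m*n (y (m ∸ k)) (ih k<m)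
    ... | inj₂ refl = subst (λ z → q ∣ (∂^ d w ⊖ w) k * z)
                        (sym (trans (cong y (ℕₚ.n∸n≡0 k)) y0≡0))
                        (subst (q ∣_) (sym (ℤₚ.*-zeroʳ ((∂^ d w ⊖ w) k))) (divides 0ℤ refl))

⋆-eventuallyPeriodic : ∀ {q d y} J → NegligibleDerivatives q d y → (∀ j → J ≤ j → q ∣ y j) →
                       ∀ {w} → EventuallyPeriodic q d w → EventuallyPeriodic q d (w ⋆ y)
⋆-eventuallyPeriodic {q} {d} {y} J negligible q∣y {w} (periodicFrom n₀ w-periodic) =
  periodicFrom (J ℕ.+ n₀) λ m J+n₀≤m →
    ⋆-shift-∣ {y = y} negligible w m (∣-binsum m (λ i j → (∂^ d w ⊖ w) i * y j) (λ k _ → termwise m J+n₀≤m k))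
  where
  termwise : ∀ m → J ℕ.+ n₀ ≤ m → ∀ k → q ∣ (∂^ d w ⊖ w) k * y (m ∸ k)
  termwise m J+n₀≤m k with n₀ ℕ.≤? k
  ... | yes n₀≤k = ∣m⇒∣m*n (y (m ∸ k)) (w-periodic k n₀≤k)
  ... | no  n₀≰k = ∣n⇒∣m*n ((∂^ d w ⊖ w) k) (q∣y (m ∸ k)
                     (ℕₚ.≤-trans (ℕₚ.m+n≤o⇒m≤o∸n J J+n₀≤m)
                                 (ℕₚ.∸-monoʳ-≤ m (ℕₚ.<⇒≤ (ℕₚ.≰⇒> n₀≰k)))))

eventuallyPeriodic-cong : ∀ {q d a b} → a ≗ b → EventuallyPeriodic q d a → EventuallyPeriodic q d b
eventuallyPeriodic-cong {q} {d} a≗b (periodicFrom n₀ a-periodic) =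
  periodicFrom n₀ λ m n₀≤m → subst (q ∣_) (cong₂ _-_ (a≗b (d ℕ.+ m)) (a≗b m)) (a-periodic m n₀≤m)

eventuallyPeriodic-𝟎 : ∀ {q d} → EventuallyPeriodic q d 𝟎
eventuallyPeriodic-𝟎 = periodicFrom 0 λ _ _ → divides 0ℤ refl

eventuallyPeriodic-⊕ : ∀ {q d a b} → EventuallyPeriodic q d a → EventuallyPeriodic q d b →
                       EventuallyPeriodic q d (a ⊕ b)
eventuallyPeriodic-⊕ {q} {d} {a} {b} (periodicFrom n₀ a-periodic) (periodicFrom n₁ b-periodic) =
  periodicFrom (n₀ ℕ.+ n₁) λ m n₀+n₁≤m →
  subst (q ∣_) (sym (regroup (a (d ℕ.+ m)) (b (d ℕ.+ m)) (a m) (b m)))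
    (∣m∣n⇒∣m+n (a-periodic m (ℕₚ.m+n≤o⇒m≤o n₀ n₀+n₁≤m))
               (b-periodic m (ℕₚ.m+n≤o⇒n≤o n₀ n₀+n₁≤m)))
  where
  regroup : ∀ x y x′ y′ → (x + y) - (x′ + y′) ≡ (x - x′) + (y - y′)
  regroup = solve-∀

eventuallyPeriodic-⊖ : ∀ {q d a b} → EventuallyPeriodic q d a → EventuallyPeriodic q d b →
                       EventuallyPeriodic q d (a ⊖ b)
eventuallyPeriodic-⊖ {q} {d} {a} {b} (periodicFrom n₀ a-periodic) (periodicFrom n₁ b-periodic) =
  periodicFrom (n₀ ℕ.+ n₁) λ m n₀+n₁≤m →
  subst (q ∣_) (sym (regroup (a (d ℕ.+ m)) (b (d ℕ.+ m)) (a m) (b m)))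
    (∣m∣n⇒∣m-n (a-periodic m (ℕₚ.m+n≤o⇒m≤o n₀ n₀+n₁≤m))
               (b-periodic m (ℕₚ.m+n≤o⇒n≤o n₀ n₀+n₁≤m)))
  where
  regroup : ∀ x y x′ y′ → (x - y) - (x′ - y′) ≡ (x - x′) - (y - y′)
  regroup = solve-∀

eventuallyPeriodic-· : ∀ {q d} c {a} → EventuallyPeriodic q d a → EventuallyPeriodic q d (c · a)
eventuallyPeriodic-· {q} {d} c {a} (periodicFrom n₀ a-periodic) = periodicFrom n₀ λ m n₀≤m →
  subst (q ∣_) (factor c (a (d ℕ.+ m)) (a m)) (∣n⇒∣m*n c (a-periodic m n₀≤m))
  where
  factor : ∀ c x y → c * (x - y) ≡ c * x - c * y
  factor = solve-∀

eventuallyPeriodic-≡mod : ∀ {q d a b} → (∀ m → q ∣ a m - b m) → EventuallyPeriodic q d b → EventuallyPeriodic q d a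
eventuallyPeriodic-≡mod {q} {d} {a} {b} a≡b (periodicFrom n₀ b-periodic) = periodicFrom n₀ λ m n₀≤m →
  subst (q ∣_) (sym (regroup (a (d ℕ.+ m)) (a m) (b (d ℕ.+ m)) (b m)))
    (∣m∣n⇒∣m-n (∣m∣n⇒∣m+n (a≡b (d ℕ.+ m)) (b-periodic m n₀≤m)) (a≡b m))
  where
  regroup : ∀ x y x′ y′ → x - y ≡ (x - x′) + (x′ - y′) - (y - y′)
  regroup = solve-∀

⋆-δ⊖-eventuallyPeriodic : ∀ {q d y} J → NegligibleDerivatives q d y → (∀ j → J ≤ j → q ∣ y j) →
                          ∀ {w} → EventuallyPeriodic q d w → EventuallyPeriodic q d (w ⋆ (δ ⊖ y))
⋆-δ⊖-eventuallyPeriodic {y = y} J negligible q∣y {w} w-periodic = eventuallyPeriodic-cong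
  (λ m → sym (trans (⋆-distribˡ-⊖ w δ y m) (cong (_- (w ⋆ y) m) (⋆-identityʳ w m))))
  (eventuallyPeriodic-⊖ w-periodic (⋆-eventuallyPeriodic {y = y} J negligible q∣y w-periodic))

negligibleDerivatives : ∀ {p R d y} → Prime p → p ^ R ℕ∣.∣ d →
                        (∀ a j → p ^ a ≤ suc j → + (p ^ a) ∣ y (suc j)) →
                        NegligibleDerivatives (+ (p ^ R)) d y
negligibleDerivatives {p} {R} {d} {y} p-prime p^R∣d valuation k j =
  ∣ᵤ⇒∣ (subst (p ^ R ℕ∣.∣_) (sym (ℤₚ.abs-* (+ (d C suc k)) (y (suc k ℕ.+ j))))
    (p^R∣d⇒p^R∣dC[1+k]*y p-prime R p^R∣d (λ a p^a∣1+k →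
      ∣⇒∣ᵤ (valuation a (k ℕ.+ j) (ℕₚ.≤-trans (ℕ∣.∣⇒≤ p^a∣1+k) (s≤s (ℕₚ.m≤m+n k j)))))))

-- The recurrence satisfied by e^{-z} Σ z^{Nn}/(Nn)!

∂-⋆-ex-1 : ∀ a m → (∂ a ⋆ ex -1ℤ) m ≡ (a ⋆ ex -1ℤ) (suc m) + (a ⋆ ex -1ℤ) m
∂-⋆-ex-1 a m = begin
  (∂ a ⋆ ex -1ℤ) m                                       ≡⟨ solve-for ((∂ a ⋆ ex -1ℤ) m) ((a ⋆ ex -1ℤ) m) ⟩
  ((∂ a ⋆ ex -1ℤ) m + -1ℤ * (a ⋆ ex -1ℤ) m) + (a ⋆ ex -1ℤ) m
    ≡⟨ cong (λ z → (∂ a ⋆ ex -1ℤ) m + z + (a ⋆ ex -1ℤ) m) (⋆-· -1ℤ a (ex -1ℤ) m) ⟨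
  ((∂ a ⋆ ex -1ℤ) m + (a ⋆ ∂ (ex -1ℤ)) m) + (a ⋆ ex -1ℤ) m
    ≡⟨ cong (_+ (a ⋆ ex -1ℤ) m) (⋆-suc a (ex -1ℤ) m) ⟨
  (a ⋆ ex -1ℤ) (suc m) + (a ⋆ ex -1ℤ) m                   ∎
  where
  open ≡-Reasoning
  solve-for : ∀ x y → x ≡ (x + -1ℤ * y) + y
  solve-for = solve-∀

binsum-iterate : ∀ (P : ℕ → ℕ → ℤ) → (∀ k m → P (suc k) m ≡ P k (suc m) + P k m) →
                 ∀ n m → P n m ≡ binsum n (λ i _ → P 0 (i ℕ.+ m))
binsum-iterate P P-suc zero    m = sym (trans (ℤₚ.+-identityʳ _) (ℤₚ.*-identityˡ _))
binsum-iterate P P-suc (suc n) m = begin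
  P (suc n) m
    ≡⟨ P-suc n m ⟩
  P n (suc m) + P n m
    ≡⟨ cong₂ _+_ (binsum-iterate P P-suc n (suc m)) (binsum-iterate P P-suc n m) ⟩
  binsum n (λ i _ → P 0 (i ℕ.+ suc m)) + binsum n (λ i _ → P 0 (i ℕ.+ m))
    ≡⟨ cong (_+ binsum n (λ i _ → P 0 (i ℕ.+ m)))
         (binsum-cong n {λ i _ → P 0 (i ℕ.+ suc m)} {λ i _ → P 0 (suc i ℕ.+ m)} (λ i _ → cong (P 0) (ℕₚ.+-suc i m))) ⟩
  binsum n (λ i _ → P 0 (suc i ℕ.+ m)) + binsum n (λ i _ → P 0 (i ℕ.+ m))
    ≡⟨ binsum-suc n (λ i _ → P 0 (i ℕ.+ m)) ⟨
  binsum (suc n) (λ i _ → P 0 (i ℕ.+ m))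
    ∎
  where open ≡-Reasoning

periodic⇒⋆ex-1-recurrence : ∀ N g → ∂^ N g ≗ g →
                            ∀ m → binsum N (λ i _ → (g ⋆ ex -1ℤ) (i ℕ.+ m)) ≡ (g ⋆ ex -1ℤ) m
periodic⇒⋆ex-1-recurrence N g g-periodic m = trans
  (sym (binsum-iterate (λ k → ∂^ k g ⋆ ex -1ℤ) P-suc N m))
  (⋆-congˡ (ex -1ℤ) g-periodic m)
  where
  P-suc : ∀ k m → (∂^ (suc k) g ⋆ ex -1ℤ) m ≡ (∂^ k g ⋆ ex -1ℤ) (suc m) + (∂^ k g ⋆ ex -1ℤ) m
  P-suc k m = trans (⋆-congˡ (ex -1ℤ) (λ j → cong g (sym (ℕₚ.+-suc k j))) m) (∂-⋆-ex-1 (∂^ k g) m)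

φ : ℕ → Seq
φ N = χ N ⋆ ex -1ℤ

ρ : ℕ → Seq
ρ N = δ ⊖ φ N

φ-recurrence : ∀ N m → binsum N (λ i _ → φ N (i ℕ.+ m)) ≡ φ N m
φ-recurrence N = periodic⇒⋆ex-1-recurrence N (χ N) (χ-periodic N)

ρ-head : ∀ N → ρ N 0 ≡ 0ℤ
ρ-head N = trans (cong (_-_ 1ℤ) (trans (⋆-head (χ N) (ex -1ℤ)) (cong (_* 1ℤ) (χ-head N)))) (ℤₚ.+-inverseʳ 1ℤ)

ρ-suc : ∀ N j → ρ N (suc j) ≡ - φ N (suc j)
ρ-suc N j = ℤₚ.+-identityˡ (- φ N (suc j))

𝓔≗ex-1⊕𝓔⋆ρ : ∀ N → 𝓔 N ≗ ex -1ℤ ⊕ 𝓔 N ⋆ ρ N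
𝓔≗ex-1⊕𝓔⋆ρ N m = begin
  𝓔 N m                                     ≡⟨ rearrange (𝓔 N m) ((𝓔 N ⋆ ρ N) m) ⟩
  (𝓔 N m - (𝓔 N ⋆ ρ N) m) + (𝓔 N ⋆ ρ N) m   ≡⟨ cong (_+ (𝓔 N ⋆ ρ N) m) 𝓔-𝓔⋆ρ≡ex-1 ⟩
  ex -1ℤ m + (𝓔 N ⋆ ρ N) m                  ∎
  where
  open ≡-Reasoning
  rearrange : ∀ x y → x ≡ (x - y) + y
  rearrange = solve-∀
  𝓔-𝓔⋆ρ≡ex-1 : 𝓔 N m - (𝓔 N ⋆ ρ N) m ≡ ex -1ℤ m
  𝓔-𝓔⋆ρ≡ex-1 = begin
    𝓔 N m - (𝓔 N ⋆ ρ N) m                ≡⟨ cong (_- (𝓔 N ⋆ ρ N) m) (⋆-identityʳ (𝓔 N) m) ⟨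
    (𝓔 N ⋆ δ) m - (𝓔 N ⋆ ρ N) m          ≡⟨ ⋆-distribˡ-⊖ (𝓔 N) δ (ρ N) m ⟨
    (𝓔 N ⋆ (δ ⊖ ρ N)) m                  ≡⟨ ⋆-congʳ (𝓔 N) (λ k → δ-[δ-x]≡x (δ k) (φ N k)) m ⟩
    (𝓔 N ⋆ (χ N ⋆ ex -1ℤ)) m             ≡⟨ ⋆-assoc (𝓔 N) (χ N) (ex -1ℤ) m ⟨
    ((𝓔 N ⋆ χ N) ⋆ ex -1ℤ) m             ≡⟨ ⋆-congˡ (ex -1ℤ) (𝓔⋆χ≗δ N) m ⟩
    (δ ⋆ ex -1ℤ) m                       ≡⟨ ⋆-identityˡ (ex -1ℤ) m ⟩
    ex -1ℤ m                             ∎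
    where
    δ-[δ-x]≡x : ∀ d x → d - (d - x) ≡ x
    δ-[δ-x]≡x = solve-∀

2-adic-valuation : ∀ (x : Seq) → (∀ m → x (3 ℕ.+ m) + + 4 * x (2 ℕ.+ m) + + 6 * x (1 ℕ.+ m) + + 4 * x m ≡ 0ℤ) →
                   ∀ a j → a ℕ.* 2 ≤ suc j → + (2 ^ a) ∣ + 2 * x j
2-adic-valuation x rec zero j _ = divides (+ 2 * x j) (sym (ℤₚ.*-identityʳ _))
2-adic-valuation x rec (suc zero)          j       _ = divides (x j) (ℤₚ.*-comm (+ 2) (x j))
2-adic-valuation x rec (suc (suc a)) (suc (suc (suc j))) (s≤s (s≤s (s≤s (s≤s 2a≤j)))) =
  subst (+ (2 ^ suc (suc a)) ∣_) (sym (isolate (x (3 ℕ.+ j)) (x (2 ℕ.+ j)) (x (1 ℕ.+ j)) (x j) (rec j)))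
    (∣m⇒∣-m (∣m∣n⇒∣m+n (∣m∣n⇒∣m+n
      (4*-∣ (2-adic-valuation x rec a (2 ℕ.+ j) (ℕₚ.≤-trans 2a≤j (ℕₚ.m≤n+m j 3))))
      (∣n⇒∣m*n (+ 3) (subst (_∣ _) (sym (ℤₚ.pos-* 2 (2 ^ suc a)))
        (*-monoʳ-∣ (+ 2) (2-adic-valuation x rec (suc a) (1 ℕ.+ j) (s≤s (s≤s 2a≤j)))))))
      (4*-∣ (2-adic-valuation x rec a j (ℕₚ.≤-trans 2a≤j (ℕₚ.n≤1+n j))))))
  where
  isolate : ∀ x₃ x₂ x₁ x₀ → x₃ + + 4 * x₂ + + 6 * x₁ + + 4 * x₀ ≡ 0ℤ →
            + 2 * x₃ ≡ - (+ 4 * (+ 2 * x₂) + + 3 * (+ 2 * (+ 2 * x₁)) + + 4 * (+ 2 * x₀))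
  isolate x₃ x₂ x₁ x₀ eq = begin
    + 2 * x₃                                  ≡⟨ solve-for x₃ x₂ x₁ x₀ ⟩
    + 2 * (x₃ + + 4 * x₂ + + 6 * x₁ + + 4 * x₀) - (+ 4 * (+ 2 * x₂) + + 3 * (+ 2 * (+ 2 * x₁)) + + 4 * (+ 2 * x₀))
      ≡⟨ cong (λ z → + 2 * z - (+ 4 * (+ 2 * x₂) + + 3 * (+ 2 * (+ 2 * x₁)) + + 4 * (+ 2 * x₀))) eq ⟩
    0ℤ - (+ 4 * (+ 2 * x₂) + + 3 * (+ 2 * (+ 2 * x₁)) + + 4 * (+ 2 * x₀))
      ≡⟨ ℤₚ.+-identityˡ _ ⟩
    - (+ 4 * (+ 2 * x₂) + + 3 * (+ 2 * (+ 2 * x₁)) + + 4 * (+ 2 * x₀))  ∎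
    where
    open ≡-Reasoning
    solve-for : ∀ x₃ x₂ x₁ x₀ → + 2 * x₃ ≡
      + 2 * (x₃ + + 4 * x₂ + + 6 * x₁ + + 4 * x₀) - (+ 4 * (+ 2 * x₂) + + 3 * (+ 2 * (+ 2 * x₁)) + + 4 * (+ 2 * x₀))
    solve-for = solve-∀
  4*-∣ : ∀ {z} → + (2 ^ a) ∣ z → + (2 ^ suc (suc a)) ∣ + 4 * z
  4*-∣ {z} 2^a∣z =
    subst (_∣ + 4 * z) (trans (sym (ℤₚ.pos-* 4 (2 ^ a))) (cong +_ (ℕₚ.*-assoc 2 2 (2 ^ a)))) (*-monoʳ-∣ (+ 4) 2^a∣z)
2-adic-valuation x rec (suc (suc a)) 0 (s≤s ())
2-adic-valuation x rec (suc (suc a)) 1 (s≤s (s≤s ()))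
2-adic-valuation x rec (suc (suc a)) 2 (s≤s (s≤s (s≤s ())))

3-adic-valuation : ∀ (x : Seq) → (∀ m → x (2 ℕ.+ m) + + 3 * x (1 ℕ.+ m) + + 3 * x m ≡ 0ℤ) →
                   ∀ a j → a ℕ.* 2 ≤ j → + (3 ^ a) ∣ x j
3-adic-valuation x rec zero    j _ = divides (x j) (sym (ℤₚ.*-identityʳ (x j)))
3-adic-valuation x rec (suc a) (suc (suc j)) (s≤s (s≤s 2a≤j)) =
  subst₂ _∣_ (sym (ℤₚ.pos-* 3 (3 ^ a))) (sym (isolate (x (2 ℕ.+ j)) (x (1 ℕ.+ j)) (x j) (rec j)))
    (*-monoʳ-∣ (+ 3) (∣m⇒∣-m (∣m∣n⇒∣m+n
      (3-adic-valuation x rec a (1 ℕ.+ j) (ℕₚ.≤-trans 2a≤j (ℕₚ.n≤1+n j)))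
      (3-adic-valuation x rec a j 2a≤j))))
  where
  isolate : ∀ x₂ x₁ x₀ → x₂ + + 3 * x₁ + + 3 * x₀ ≡ 0ℤ → x₂ ≡ + 3 * - (x₁ + x₀)
  isolate x₂ x₁ x₀ eq = begin
    x₂                                                ≡⟨ solve-for x₂ x₁ x₀ ⟩
    (x₂ + + 3 * x₁ + + 3 * x₀) + + 3 * - (x₁ + x₀)    ≡⟨ cong (_+ + 3 * - (x₁ + x₀)) eq ⟩
    0ℤ + + 3 * - (x₁ + x₀)                            ≡⟨ ℤₚ.+-identityˡ _ ⟩
    + 3 * - (x₁ + x₀)                                 ∎
    where
    open ≡-Reasoning
    solve-for : ∀ x₂ x₁ x₀ → x₂ ≡ (x₂ + + 3 * x₁ + + 3 * x₀) + + 3 * - (x₁ + x₀)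
    solve-for = solve-∀
3-adic-valuation x rec (suc a) 0 ()
3-adic-valuation x rec (suc a) 1 (s≤s ())

a*2≤2^a : ∀ a → a ℕ.* 2 ≤ 2 ^ a
a*2≤2^a zero          = z≤n
a*2≤2^a (suc zero)    = ℕₚ.≤-refl
a*2≤2^a (suc (suc a)) = ℕₚ.+-mono-≤ (ℕₚ.*-monoʳ-≤ 2 (ℕₚ.m^n>0 2 a))
  (ℕₚ.≤-trans (a*2≤2^a (suc a)) (ℕₚ.≤-reflexive (sym (ℕₚ.+-identityʳ (2 ^ suc a)))))

1+a*2≤3^a : ∀ a → suc (a ℕ.* 2) ≤ 3 ^ a
1+a*2≤3^a zero    = ℕₚ.≤-refl
1+a*2≤3^a (suc a) = ℕₚ.+-mono-≤ (ℕₚ.m^n>0 3 a) (ℕₚ.+-mono-≤ (ℕₚ.m^n>0 3 a)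
  (ℕₚ.≤-trans (1+a*2≤3^a a) (ℕₚ.≤-reflexive (sym (ℕₚ.+-identityʳ (3 ^ a))))))

-- N = 4

ex-1-periodic : ∀ r → Periodic (+ (2 ^ r)) (2 ^ suc r) (ex -1ℤ)
ex-1-periodic r m = subst (+ (2 ^ r) ∣_) (sym difference≡0) (divides 0ℤ refl)
  where
  open ≡-Reasoning
  s = -1ℤ ℤ.^ m
  [-1]^d≡1 : -1ℤ ℤ.^ (2 ^ suc r) ≡ 1ℤ
  [-1]^d≡1 = trans (sym (ℤₚ.^-*-assoc -1ℤ 2 (2 ^ r))) (ℤₚ.^-zeroˡ (2 ^ r))
  difference≡0 : -1ℤ ℤ.^ (2 ^ suc r ℕ.+ m) - s ≡ 0ℤ
  difference≡0 = begin
    -1ℤ ℤ.^ (2 ^ suc r ℕ.+ m) - s     ≡⟨ cong (_- s) (ℤₚ.^-distribˡ-+-* -1ℤ (2 ^ suc r) m) ⟩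
    -1ℤ ℤ.^ (2 ^ suc r) * s - s       ≡⟨ cong (λ z → z * s - s) [-1]^d≡1 ⟩
    1ℤ * s - s                        ≡⟨ cong (_- s) (ℤₚ.*-identityˡ s) ⟩
    s - s                             ≡⟨ ℤₚ.+-inverseʳ s ⟩
    0ℤ                                ∎

φ₄-recurrence : ∀ m →
  ∂ (φ 4) (3 ℕ.+ m) + + 4 * ∂ (φ 4) (2 ℕ.+ m) + + 6 * ∂ (φ 4) (1 ℕ.+ m) + + 4 * ∂ (φ 4) m ≡ 0ℤ
φ₄-recurrence m = cancel (φ 4 m) (φ 4 (1 ℕ.+ m)) (φ 4 (2 ℕ.+ m)) (φ 4 (3 ℕ.+ m)) (φ 4 (4 ℕ.+ m)) (φ-recurrence 4 m)
  where
  rearrange : ∀ a b c d e → e + + 4 * d + + 6 * c + + 4 * b ≡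
              (+ 1 * a + (+ 4 * b + (+ 6 * c + (+ 4 * d + (+ 1 * e + 0ℤ))))) - a
  rearrange = solve-∀
  cancel : ∀ a b c d e → + 1 * a + (+ 4 * b + (+ 6 * c + (+ 4 * d + (+ 1 * e + 0ℤ)))) ≡ a →
           e + + 4 * d + + 6 * c + + 4 * b ≡ 0ℤ
  cancel a b c d e eq = trans (rearrange a b c d e) (trans (cong (_- a) eq) (ℤₚ.+-inverseʳ a))

ρ₄-negligible : ∀ r → NegligibleDerivatives (+ (2 ^ r)) (2 ^ suc r) (ρ 4)
ρ₄-negligible r k j = *-cancelˡ-∣ (+ 2)
  (subst₂ _∣_ (ℤₚ.pos-* 2 (2 ^ r)) (*-swapˡ (+ (2 ^ suc r C suc k)) (+ 2) (ρ 4 (suc k ℕ.+ j)))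
    (negligibleDerivatives {R = suc r} {2 ^ suc r} {+ 2 · ρ 4} prime[2] ℕ∣.∣-refl valuation k j))
  where
  *-swapˡ : ∀ x y z → x * (y * z) ≡ y * (x * z)
  *-swapˡ = solve-∀
  valuation : ∀ a j → 2 ^ a ≤ suc j → + (2 ^ a) ∣ + 2 * ρ 4 (suc j)
  valuation a j 2^a≤1+j = subst (+ (2 ^ a) ∣_)
    (trans (ℤₚ.neg-distribʳ-* (+ 2) (φ 4 (suc j))) (cong (+ 2 *_) (sym (ρ-suc 4 j))))
    (∣m⇒∣-m (2-adic-valuation (∂ (φ 4)) φ₄-recurrence a j (ℕₚ.≤-trans (a*2≤2^a a) 2^a≤1+j)))

𝓔₄-periodic : ∀ r → Periodic (+ (2 ^ r)) (2 ^ suc r) (𝓔 4)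
𝓔₄-periodic r = periodic-fixpoint {d = 2 ^ suc r} {u = ex -1ℤ} {y = ρ 4}
  (ρ₄-negligible r) (ρ-head 4) (ex-1-periodic r) (𝓔≗ex-1⊕𝓔⋆ρ 4)

p∣x⇒p^n∣x^n : ∀ {p x} n → + p ∣ x → + (p ^ n) ∣ x ℤ.^ n
p∣x⇒p^n∣x^n zero    _   = ∣-refl
p∣x⇒p^n∣x^n {p} {x} (suc n) p∣x = subst (_∣ x ℤ.^ suc n) (sym (ℤₚ.pos-* p (p ^ n)))
  (∣-trans (*-monoʳ-∣ (+ p) (p∣x⇒p^n∣x^n n p∣x)) (*-monoˡ-∣ (x ℤ.^ n) p∣x))

3∣q⇒q∣x-1⇒3q∣x³-1 : ∀ {q x} → + 3 ∣ q → q ∣ x - 1ℤ → + 3 * q ∣ x ℤ.^ 3 - 1ℤ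
3∣q⇒q∣x-1⇒3q∣x³-1 {x = x} (divides s refl) (divides t x-1≡t[3s]) =
  divides (t * t * t * s * (s * + 3) + t * t * (s * + 3) + t)
    (trans (cong (λ z → z ℤ.^ 3 - 1ℤ) x≡t[3s]+1) (expand t s))
  where
  x≡[x-1]+1 : ∀ x → x ≡ (x - 1ℤ) + 1ℤ
  x≡[x-1]+1 = solve-∀
  x≡t[3s]+1 : x ≡ t * (s * + 3) + 1ℤ
  x≡t[3s]+1 = trans (x≡[x-1]+1 x) (cong (_+ 1ℤ) x-1≡t[3s])
  expand : ∀ t s → let z = t * (s * + 3) + 1ℤ in
           z * (z * (z * 1ℤ)) - 1ℤ ≡ (t * t * t * s * (s * + 3) + t * t * (s * + 3) + t) * (+ 3 * (s * + 3))
  expand = solve-∀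

3∣x-1⇒3^[1+k]∣x^3^k-1 : ∀ k {x} → + 3 ∣ x - 1ℤ → + (3 ^ suc k) ∣ x ℤ.^ (3 ^ k) - 1ℤ
3∣x-1⇒3^[1+k]∣x^3^k-1 zero    {x} 3∣x-1 = subst (λ z → + 3 ∣ z - 1ℤ) (sym (ℤₚ.*-identityʳ x)) 3∣x-1
3∣x-1⇒3^[1+k]∣x^3^k-1 (suc k) {x} 3∣x-1 = subst₂ (λ q z → q ∣ z - 1ℤ)
  (sym (ℤₚ.pos-* 3 (3 ^ suc k))) (trans (ℤₚ.^-*-assoc x (3 ^ k) 3) (cong (x ℤ.^_) (ℕₚ.*-comm (3 ^ k) 3)))
  (3∣q⇒q∣x-1⇒3q∣x³-1 {x = x ℤ.^ (3 ^ k)}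
    (divides (+ (3 ^ k)) (trans (ℤₚ.pos-* 3 (3 ^ k)) (ℤₚ.*-comm (+ 3) (+ (3 ^ k)))))
                      (3∣x-1⇒3^[1+k]∣x^3^k-1 k {x} 3∣x-1))

3∣x⊎3∣x²-1 : ∀ x → + 3 ∣ x ⊎ + 3 ∣ x ℤ.^ 2 - 1ℤ
3∣x⊎3∣x²-1 x = by-residue (x %ℕ 3) (n%ℕd<d x 3) (a≡a%ℕn+[a/ℕn]*n x 3)
  where
  s = x /ℕ 3
  by-residue : ∀ ρ → ρ < 3 → x ≡ + ρ + s * + 3 → + 3 ∣ x ⊎ + 3 ∣ x ℤ.^ 2 - 1ℤ
  by-residue 0 _ x≡3s = inj₁ (divides s (trans x≡3s (ℤₚ.+-identityˡ _)))
  by-residue 1 _ x≡1+3s = inj₂ (divides (s * (+ 2 + s * + 3)) (trans (cong (λ z → z ℤ.^ 2 - 1ℤ) x≡1+3s) (square₁ s)))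
    where
    square₁ : ∀ s → (+ 1 + s * + 3) * ((+ 1 + s * + 3) * 1ℤ) - 1ℤ ≡ (s * (+ 2 + s * + 3)) * + 3
    square₁ = solve-∀
  by-residue 2 _ x≡2+3s = inj₂ (divides (+ 1 + s * (+ 4 + s * + 3)) (trans (cong (λ z → z ℤ.^ 2 - 1ℤ) x≡2+3s) (square₂ s)))
    where
    square₂ : ∀ s → (+ 2 + s * + 3) * ((+ 2 + s * + 3) * 1ℤ) - 1ℤ ≡ (+ 1 + s * (+ 4 + s * + 3)) * + 3
    square₂ = solve-∀
  by-residue (suc (suc (suc _))) (s≤s (s≤s (s≤s ()))) _

ex-eventuallyPeriodic : ∀ r o → EventuallyPeriodic (+ (3 ^ r)) (2 ℕ.* 3 ^ r) (ex o)
ex-eventuallyPeriodic r o with 3∣x⊎3∣x²-1 o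
... | inj₁ 3∣o    = periodicFrom r λ m r≤m →
  ∣m∣n⇒∣m-n (3^r∣o^n (2 ℕ.* 3 ^ r ℕ.+ m) (ℕₚ.≤-trans r≤m (ℕₚ.m≤n+m m _))) (3^r∣o^n m r≤m)
  where
  3^r∣o^n : ∀ n → r ≤ n → + (3 ^ r) ∣ o ℤ.^ n
  3^r∣o^n n r≤n = subst (λ k → + (3 ^ r) ∣ o ℤ.^ k) (ℕₚ.m+[n∸m]≡n r≤n)
    (subst (+ (3 ^ r) ∣_) (sym (ℤₚ.^-distribˡ-+-* o r (n ∸ r))) (∣m⇒∣m*n (o ℤ.^ (n ∸ r)) (p∣x⇒p^n∣x^n r 3∣o)))
... | inj₂ 3∣o²-1 = periodicFrom 0 λ m _ →
  subst (+ (3 ^ r) ∣_) (sym (factor m)) (∣m⇒∣m*n (o ℤ.^ m) 3^r∣o^d-1)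
  where
  d = 2 ℕ.* 3 ^ r
  3^r∣o^d-1 : + (3 ^ r) ∣ o ℤ.^ d - 1ℤ
  3^r∣o^d-1 = ∣-trans (divides (+ 3) (ℤₚ.pos-* 3 (3 ^ r)))
    (subst (λ z → + (3 ^ suc r) ∣ z - 1ℤ) (ℤₚ.^-*-assoc o 2 (3 ^ r)) (3∣x-1⇒3^[1+k]∣x^3^k-1 r 3∣o²-1))
  x*y-y≡[x-1]*y : ∀ x y → x * y - y ≡ (x - 1ℤ) * y
  x*y-y≡[x-1]*y = solve-∀
  factor : ∀ m → o ℤ.^ (d ℕ.+ m) - o ℤ.^ m ≡ (o ℤ.^ d - 1ℤ) * o ℤ.^ m
  factor m = trans (cong (_- o ℤ.^ m) (ℤₚ.^-distribˡ-+-* o d m)) (x*y-y≡[x-1]*y (o ℤ.^ d) (o ℤ.^ m))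

x³≡x⇒x^3^k≡x : ∀ {x} → x ℤ.^ 3 ≡ x → ∀ k → x ℤ.^ (3 ^ k) ≡ x
x³≡x⇒x^3^k≡x {x} x³≡x zero    = ℤₚ.*-identityʳ x
x³≡x⇒x^3^k≡x {x} x³≡x (suc k) = begin
  x ℤ.^ (3 ℕ.* 3 ^ k)     ≡⟨ cong (x ℤ.^_) (ℕₚ.*-comm 3 (3 ^ k)) ⟩
  x ℤ.^ (3 ^ k ℕ.* 3)     ≡⟨ ℤₚ.^-*-assoc x (3 ^ k) 3 ⟨
  (x ℤ.^ (3 ^ k)) ℤ.^ 3   ≡⟨ cong (ℤ._^ 3) (x³≡x⇒x^3^k≡x x³≡x k) ⟩
  x ℤ.^ 3                 ≡⟨ x³≡x ⟩
  x                       ∎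
  where open ≡-Reasoning

3-prime : Prime 3
3-prime = from-yes (prime? 3)

3^r∣2x⇒3^r∣x : ∀ r {x} → + (3 ^ r) ∣ + 2 * x → + (3 ^ r) ∣ x
3^r∣2x⇒3^r∣x r {x} 3^r∣2x = ∣ᵤ⇒∣ (p∤t⇒p^R∣t*x⇒p^R∣x 3-prime r (from-no (3 ∣? 2))
  (subst (3 ^ r ℕ∣.∣_) (ℤₚ.abs-* (+ 2) x) (∣⇒∣ᵤ 3^r∣2x)))

-- N = 6

χ₃⊕reflect-χ₃≗2·χ₆ : χ 3 ⊕ reflect (χ 3) ≗ + 2 · χ 6
χ₃⊕reflect-χ₃≗2·χ₆ 0 = refl
χ₃⊕reflect-χ₃≗2·χ₆ 1 = refl
χ₃⊕reflect-χ₃≗2·χ₆ 2 = refl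
χ₃⊕reflect-χ₃≗2·χ₆ 3 = refl
χ₃⊕reflect-χ₃≗2·χ₆ 4 = refl
χ₃⊕reflect-χ₃≗2·χ₆ 5 = refl
χ₃⊕reflect-χ₃≗2·χ₆ (suc (suc (suc (suc (suc (suc j)))))) =
  trans (cong₂ _+_ χ₃[6+j]≡χ₃[j] (cong₂ _*_ (sign-period (-1ℤ ℤ.^ j)) χ₃[6+j]≡χ₃[j]))
    (trans (χ₃⊕reflect-χ₃≗2·χ₆ j) (cong (+ 2 *_) (sym (χ-periodic 6 j))))
  where
  χ₃[6+j]≡χ₃[j] : χ 3 (6 ℕ.+ j) ≡ χ 3 j
  χ₃[6+j]≡χ₃[j] = trans (χ-periodic 3 (3 ℕ.+ j)) (χ-periodic 3 j)
  sign-period : ∀ s → -1ℤ * (-1ℤ * (-1ℤ * (-1ℤ * (-1ℤ * (-1ℤ * s))))) ≡ s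
  sign-period = solve-∀

-- With c(z) = Σ z^{3n}/(3n)!, the series of U is -e^{-2z} φ₃(-z) = -e^{-z} c(-z), so the series of
-- φ 3 ⊖ U is e^{-z} (c(z) + c(-z)) = 2 e^{-z} Σ z^{6n}/(6n)!.
U : Seq
U = -1ℤ · (ex (- + 2) ⋆ reflect (φ 3))

ex-2⋆reflect-φ₃≗reflect-χ₃⋆ex-1 : ex (- + 2) ⋆ reflect (φ 3) ≗ reflect (χ 3) ⋆ ex -1ℤ
ex-2⋆reflect-φ₃≗reflect-χ₃⋆ex-1 = begin
  ex (- + 2) ⋆ reflect (χ 3 ⋆ ex -1ℤ)            ≈⟨ ⋆-congʳ (ex (- + 2)) (reflect-⋆ (χ 3) (ex -1ℤ)) ⟩
  ex (- + 2) ⋆ (reflect (χ 3) ⋆ reflect (ex -1ℤ)) ≈⟨ ⋆-congʳ (ex (- + 2)) (⋆-congʳ (reflect (χ 3)) (reflect-ex -1ℤ)) ⟩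
  ex (- + 2) ⋆ (reflect (χ 3) ⋆ ex 1ℤ)           ≈⟨ x∙yz≈y∙xz (ex (- + 2)) (reflect (χ 3)) (ex 1ℤ) ⟩
  reflect (χ 3) ⋆ (ex (- + 2) ⋆ ex 1ℤ)           ≈⟨ ⋆-congʳ (reflect (χ 3)) (ex-⋆-ex (- + 2) 1ℤ) ⟩
  reflect (χ 3) ⋆ ex -1ℤ                          ∎
  where open ≗-Reasoning

φ₃⊖U≗2·χ₆⋆ex-1 : φ 3 ⊖ U ≗ (+ 2 · χ 6) ⋆ ex -1ℤ
φ₃⊖U≗2·χ₆⋆ex-1 = begin
  φ 3 ⊖ U                                          ≈⟨ (λ m → sub-neg (φ 3 m) ((ex (- + 2) ⋆ reflect (φ 3)) m)) ⟩
  φ 3 ⊕ ex (- + 2) ⋆ reflect (φ 3)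
    ≈⟨ (λ m → cong (_+_ (φ 3 m)) (ex-2⋆reflect-φ₃≗reflect-χ₃⋆ex-1 m)) ⟩
  χ 3 ⋆ ex -1ℤ ⊕ reflect (χ 3) ⋆ ex -1ℤ             ≈⟨ ⋆-distribʳ-⊕ (ex -1ℤ) (χ 3) (reflect (χ 3)) ⟨
  (χ 3 ⊕ reflect (χ 3)) ⋆ ex -1ℤ                    ≈⟨ ⋆-congˡ (ex -1ℤ) χ₃⊕reflect-χ₃≗2·χ₆ ⟩
  (+ 2 · χ 6) ⋆ ex -1ℤ                              ∎
  where
  open ≗-Reasoning
  sub-neg : ∀ x y → x - -1ℤ * y ≡ x + y
  sub-neg = solve-∀

𝓔₆⋆[φ₃⊖U]≗2·ex-1 : 𝓔 6 ⋆ (φ 3 ⊖ U) ≗ + 2 · ex -1ℤ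
𝓔₆⋆[φ₃⊖U]≗2·ex-1 = begin
  𝓔 6 ⋆ (φ 3 ⊖ U)                  ≈⟨ ⋆-congʳ (𝓔 6) φ₃⊖U≗2·χ₆⋆ex-1 ⟩
  𝓔 6 ⋆ ((+ 2 · χ 6) ⋆ ex -1ℤ)     ≈⟨ ⋆-assoc (𝓔 6) (+ 2 · χ 6) (ex -1ℤ) ⟨
  (𝓔 6 ⋆ (+ 2 · χ 6)) ⋆ ex -1ℤ     ≈⟨ ⋆-congˡ (ex -1ℤ) (⋆-· (+ 2) (𝓔 6) (χ 6)) ⟩
  (+ 2 · (𝓔 6 ⋆ χ 6)) ⋆ ex -1ℤ     ≈⟨ ⋆-congˡ (ex -1ℤ) (·-congʳ (+ 2) (𝓔⋆χ≗δ 6)) ⟩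
  (+ 2 · δ) ⋆ ex -1ℤ               ≈⟨ ·-⋆ (+ 2) δ (ex -1ℤ) ⟩
  + 2 · (δ ⋆ ex -1ℤ)               ≈⟨ ·-congʳ (+ 2) (⋆-identityˡ (ex -1ℤ)) ⟩
  + 2 · ex -1ℤ                     ∎
  where open ≗-Reasoning

geometric : Seq → Seq → ℕ → Seq
geometric a b zero    = 𝟎
geometric a b (suc M) = a ⋆ geometric a b M ⊕ b ⋆^ M

⊖-⋆-geometric : ∀ a b M → (a ⊖ b) ⋆ geometric a b M ≗ a ⋆^ M ⊖ b ⋆^ M
⊖-⋆-geometric a b zero    m = trans (⋆-zeroʳ (a ⊖ b) m) (sym (ℤₚ.+-inverseʳ (δ m)))
⊖-⋆-geometric a b (suc M) m = begin
  ((a ⊖ b) ⋆ (a ⋆ G ⊕ b ⋆^ M)) m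
    ≡⟨ ⋆-distribˡ-⊕ (a ⊖ b) (a ⋆ G) (b ⋆^ M) m ⟩
  ((a ⊖ b) ⋆ (a ⋆ G)) m + ((a ⊖ b) ⋆ b ⋆^ M) m
    ≡⟨ cong₂ _+_ (x∙yz≈y∙xz (a ⊖ b) a G m) (⋆-distribʳ-⊖ (b ⋆^ M) a b m) ⟩
  (a ⋆ ((a ⊖ b) ⋆ G)) m + ((a ⋆ b ⋆^ M) m - (b ⋆ b ⋆^ M) m)
    ≡⟨ cong (_+ ((a ⋆ b ⋆^ M) m - (b ⋆ b ⋆^ M) m))
         (trans (⋆-congʳ a (⊖-⋆-geometric a b M) m) (⋆-distribˡ-⊖ a (a ⋆^ M) (b ⋆^ M) m)) ⟩
  ((a ⋆^ suc M) m - (a ⋆ b ⋆^ M) m) + ((a ⋆ b ⋆^ M) m - (b ⋆^ suc M) m)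
    ≡⟨ telescope ((a ⋆^ suc M) m) ((a ⋆ b ⋆^ M) m) ((b ⋆^ suc M) m) ⟩
  (a ⋆^ suc M) m - (b ⋆^ suc M) m
    ∎
  where
  open ≡-Reasoning
  G = geometric a b M
  telescope : ∀ x y z → (x - y) + (y - z) ≡ x - z
  telescope = solve-∀

φ₃^3^r⊖U^3^r≡2δ : ∀ r j → + (3 ^ r) ∣ (φ 3 ⋆^ 3 ^ r ⊖ U ⋆^ 3 ^ r ⊖ + 2 · δ) j
φ₃^3^r⊖U^3^r≡2δ r zero    = subst (+ (3 ^ r) ∣_)
  (sym (cong₂ (λ x y → x - y - + 2 * 1ℤ)
    (trans (⋆^-head (φ 3) (3 ^ r)) (x³≡x⇒x^3^k≡x refl r)) (trans (⋆^-head U (3 ^ r)) (x³≡x⇒x^3^k≡x refl r))))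
  (divides 0ℤ refl)
φ₃^3^r⊖U^3^r≡2δ r (suc j) = subst (+ (3 ^ r) ∣_) (sym (ℤₚ.+-identityʳ _))
  (∣m∣n⇒∣m-n (3^k∣[a⋆^3^k]-suc (φ 3) r j) (3^k∣[a⋆^3^k]-suc U r j))

𝓔₆⋆[φ₃^M⊖U^M]≗2·ex-1⋆geometric : ∀ M →
  𝓔 6 ⋆ (φ 3 ⋆^ M ⊖ U ⋆^ M) ≗ + 2 · (ex -1ℤ ⋆ geometric (φ 3) U M)
𝓔₆⋆[φ₃^M⊖U^M]≗2·ex-1⋆geometric M = begin
  𝓔 6 ⋆ (φ 3 ⋆^ M ⊖ U ⋆^ M)           ≈⟨ ⋆-congʳ (𝓔 6) (⊖-⋆-geometric (φ 3) U M) ⟨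
  𝓔 6 ⋆ ((φ 3 ⊖ U) ⋆ G)               ≈⟨ ⋆-assoc (𝓔 6) (φ 3 ⊖ U) G ⟨
  (𝓔 6 ⋆ (φ 3 ⊖ U)) ⋆ G               ≈⟨ ⋆-congˡ G 𝓔₆⋆[φ₃⊖U]≗2·ex-1 ⟩
  (+ 2 · ex -1ℤ) ⋆ G                  ≈⟨ ·-⋆ (+ 2) (ex -1ℤ) G ⟩
  + 2 · (ex -1ℤ ⋆ G)                  ∎
  where
  open ≗-Reasoning
  G = geometric (φ 3) U M

𝓔₆≡ex-1⋆geometric : ∀ r m → + (3 ^ r) ∣ 𝓔 6 m - (ex -1ℤ ⋆ geometric (φ 3) U (3 ^ r)) m
𝓔₆≡ex-1⋆geometric r m = 3^r∣2x⇒3^r∣x r (subst (+ (3 ^ r) ∣_) (negate (T m) (𝓔 6 m)) (∣m⇒∣-m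
  (subst (λ z → + (3 ^ r) ∣ z - + 2 * 𝓔 6 m) (𝓔₆⋆[φ₃^M⊖U^M]≗2·ex-1⋆geometric (3 ^ r) m)
    (∣[V⊖c·δ]⇒∣[a⋆V]-c*a (𝓔 6) (φ 3 ⋆^ 3 ^ r ⊖ U ⋆^ 3 ^ r) (+ 2) (φ₃^3^r⊖U^3^r≡2δ r) m))))
  where
  T = ex -1ℤ ⋆ geometric (φ 3) U (3 ^ r)
  negate : ∀ t e → - (+ 2 * t - + 2 * e) ≡ + 2 * (e - t)
  negate = solve-∀

φ₃-recurrence : ∀ m → ∂ (φ 3) (2 ℕ.+ m) + + 3 * ∂ (φ 3) (1 ℕ.+ m) + + 3 * ∂ (φ 3) m ≡ 0ℤ
φ₃-recurrence m = cancel (φ 3 m) (φ 3 (1 ℕ.+ m)) (φ 3 (2 ℕ.+ m)) (φ 3 (3 ℕ.+ m)) (φ-recurrence 3 m)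
  where
  rearrange : ∀ a b c d → d + + 3 * c + + 3 * b ≡ (+ 1 * a + (+ 3 * b + (+ 3 * c + (+ 1 * d + 0ℤ)))) - a
  rearrange = solve-∀
  cancel : ∀ a b c d → + 1 * a + (+ 3 * b + (+ 3 * c + (+ 1 * d + 0ℤ))) ≡ a → d + + 3 * c + + 3 * b ≡ 0ℤ
  cancel a b c d eq = trans (rearrange a b c d) (trans (cong (_- a) eq) (ℤₚ.+-inverseʳ a))

ρ₃-valuation : ∀ a j → a ℕ.* 2 ≤ j → + (3 ^ a) ∣ ρ 3 (suc j)
ρ₃-valuation a j 2a≤j = subst (+ (3 ^ a) ∣_) (sym (ρ-suc 3 j))
  (∣m⇒∣-m (3-adic-valuation (∂ (φ 3)) φ₃-recurrence a j 2a≤j))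

module _ (r : ℕ) where

  private
    q : ℤ
    q = + (3 ^ r)
    d : ℕ
    d = 2 ℕ.* 3 ^ r

  ⋆δ⊖-eventuallyPeriodic : ∀ {y} → (∀ a j → a ℕ.* 2 ≤ j → + (3 ^ a) ∣ y (suc j)) →
                           ∀ {w} → EventuallyPeriodic q d w → EventuallyPeriodic q d (w ⋆ (δ ⊖ y))
  ⋆δ⊖-eventuallyPeriodic {y} valuation = ⋆-δ⊖-eventuallyPeriodic (suc (r ℕ.* 2)) negligible eventually-divisible
    where
    negligible : NegligibleDerivatives q d y
    negligible = negligibleDerivatives {R = r} {y = y} 3-prime (ℕ∣.n∣m*n 2) (λ a j 3^a≤1+j →
      valuation a j (ℕₚ.≤-pred (ℕₚ.≤-trans (1+a*2≤3^a a) 3^a≤1+j)))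
    eventually-divisible : ∀ j → suc (r ℕ.* 2) ≤ j → q ∣ y j
    eventually-divisible (suc j) (s≤s 2r≤j) = valuation r j 2r≤j

  ⋆φ₃-eventuallyPeriodic : ∀ {w} → EventuallyPeriodic q d w → EventuallyPeriodic q d (w ⋆ φ 3)
  ⋆φ₃-eventuallyPeriodic {w} w-periodic =
    eventuallyPeriodic-cong (⋆-congʳ w (λ m → d-[d-x]≡x (δ m) (φ 3 m))) (⋆δ⊖-eventuallyPeriodic ρ₃-valuation w-periodic)
    where
    d-[d-x]≡x : ∀ d x → d - (d - x) ≡ x
    d-[d-x]≡x = solve-∀

  ⋆reflect-φ₃-eventuallyPeriodic : ∀ {w} → EventuallyPeriodic q d w → EventuallyPeriodic q d (w ⋆ reflect (φ 3))
  ⋆reflect-φ₃-eventuallyPeriodic {w} w-periodic = eventuallyPeriodic-cong (⋆-congʳ w δ⊖reflect-ρ₃≗reflect-φ₃)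
    (⋆δ⊖-eventuallyPeriodic (λ a j 2a≤j → ∣n⇒∣m*n (-1ℤ ℤ.^ suc j) (ρ₃-valuation a j 2a≤j)) w-periodic)
    where
    s*d-s*[d-x]≡s*x : ∀ s d x → s * d - s * (d - x) ≡ s * x
    s*d-s*[d-x]≡s*x = solve-∀
    δ⊖reflect-ρ₃≗reflect-φ₃ : δ ⊖ reflect (ρ 3) ≗ reflect (φ 3)
    δ⊖reflect-ρ₃≗reflect-φ₃ m =
      trans (cong (_- reflect (ρ 3) m) (sym (reflect-δ m))) (s*d-s*[d-x]≡s*x (-1ℤ ℤ.^ m) (δ m) (φ 3 m))

  ex⋆U^-eventuallyPeriodic : ∀ M o → EventuallyPeriodic q d (ex o ⋆ U ⋆^ M)
  ex⋆U^-eventuallyPeriodic zero    o =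
    eventuallyPeriodic-cong (≗-sym (⋆-identityʳ (ex o))) (ex-eventuallyPeriodic r o)
  ex⋆U^-eventuallyPeriodic (suc M) o = eventuallyPeriodic-cong (≗-sym rearrange)
    (eventuallyPeriodic-· -1ℤ (⋆reflect-φ₃-eventuallyPeriodic (ex⋆U^-eventuallyPeriodic M (o + - + 2))))
    where
    open ≗-Reasoning
    X̂ = reflect (φ 3)
    W = U ⋆^ M
    rearrange : ex o ⋆ (U ⋆ W) ≗ -1ℤ · ((ex (o + - + 2) ⋆ W) ⋆ X̂)
    rearrange = begin
      ex o ⋆ (U ⋆ W)                          ≈⟨ ⋆-congʳ (ex o) (·-⋆ -1ℤ (ex (- + 2) ⋆ X̂) W) ⟩
      ex o ⋆ (-1ℤ · ((ex (- + 2) ⋆ X̂) ⋆ W))   ≈⟨ ⋆-· -1ℤ (ex o) ((ex (- + 2) ⋆ X̂) ⋆ W) ⟩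
      -1ℤ · (ex o ⋆ ((ex (- + 2) ⋆ X̂) ⋆ W))   ≈⟨ ·-congʳ -1ℤ (⋆-assoc (ex o) (ex (- + 2) ⋆ X̂) W) ⟨
      -1ℤ · ((ex o ⋆ (ex (- + 2) ⋆ X̂)) ⋆ W)   ≈⟨ ·-congʳ -1ℤ (⋆-congˡ W (⋆-assoc (ex o) (ex (- + 2)) X̂)) ⟨
      -1ℤ · (((ex o ⋆ ex (- + 2)) ⋆ X̂) ⋆ W)   ≈⟨ ·-congʳ -1ℤ (xy∙z≈xz∙y (ex o ⋆ ex (- + 2)) X̂ W) ⟩
      -1ℤ · (((ex o ⋆ ex (- + 2)) ⋆ W) ⋆ X̂)   ≈⟨ ·-congʳ -1ℤ (⋆-congˡ X̂ (⋆-congˡ W (ex-⋆-ex o (- + 2)))) ⟩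
      -1ℤ · ((ex (o + - + 2) ⋆ W) ⋆ X̂)        ∎

  ex⋆geometric-eventuallyPeriodic : ∀ M o → EventuallyPeriodic q d (ex o ⋆ geometric (φ 3) U M)
  ex⋆geometric-eventuallyPeriodic zero    o = eventuallyPeriodic-cong (≗-sym (⋆-zeroʳ (ex o))) eventuallyPeriodic-𝟎
  ex⋆geometric-eventuallyPeriodic (suc M) o = eventuallyPeriodic-cong (≗-sym rearrange)
    (eventuallyPeriodic-⊕ (⋆φ₃-eventuallyPeriodic (ex⋆geometric-eventuallyPeriodic M o)) (ex⋆U^-eventuallyPeriodic M o))
    where
    G = geometric (φ 3) U M
    rearrange : ex o ⋆ (φ 3 ⋆ G ⊕ U ⋆^ M) ≗ (ex o ⋆ G) ⋆ φ 3 ⊕ ex o ⋆ U ⋆^ M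
    rearrange m = trans (⋆-distribˡ-⊕ (ex o) (φ 3 ⋆ G) (U ⋆^ M) m)
      (cong (_+ (ex o ⋆ U ⋆^ M) m) (x∙yz≈xz∙y (ex o) (φ 3) G m))

  𝓔₆-eventuallyPeriodic : EventuallyPeriodic q d (𝓔 6)
  𝓔₆-eventuallyPeriodic =
    eventuallyPeriodic-≡mod (𝓔₆≡ex-1⋆geometric r) (ex⋆geometric-eventuallyPeriodic (3 ^ r) -1ℤ)

-- Both congruences also hold for r = 0.
proposition1p2 : ((r : ℕ) → r ≥ 1 → (n : ℕ) →
    (+ (2 ^ r)) ℤᵘ.∣ (𝓔 4 (4 ℕ.* n ℕ.+ 2 ^ (r ℕ.+ 1)) - 𝓔 4 (4 ℕ.* n)))
    ×
    ((r : ℕ) → r ≥ 1 → ∃ λ (n₀ : ℕ) → n₀ ≥ 1 × ((n : ℕ) → n ≥ n₀ →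
    (+ (3 ^ r)) ℤᵘ.∣ (𝓔 6 (6 ℕ.* n ℕ.+ 2 ℕ.* 3 ^ r) - 𝓔 6 (6 ℕ.* n))))
proposition1p2 = part₁ , part₂
  where
  -- The index i of ∣⇒∣ᵤ is given explicitly: inferring it from the unsigned goal unfolds 𝓔.
  part₁ : ∀ r → r ≥ 1 → ∀ n → + (2 ^ r) ℤᵘ.∣ 𝓔 4 (4 ℕ.* n ℕ.+ 2 ^ (r ℕ.+ 1)) - 𝓔 4 (4 ℕ.* n)
  part₁ r _ n = ∣⇒∣ᵤ {i = 𝓔 4 (4 ℕ.* n ℕ.+ 2 ^ (r ℕ.+ 1)) - 𝓔 4 (4 ℕ.* n)}
    (subst (λ k → + (2 ^ r) ∣ 𝓔 4 k - 𝓔 4 (4 ℕ.* n)) d+4n≡4n+d (𝓔₄-periodic r (4 ℕ.* n)))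
    where
    d+4n≡4n+d : 2 ^ suc r ℕ.+ 4 ℕ.* n ≡ 4 ℕ.* n ℕ.+ 2 ^ (r ℕ.+ 1)
    d+4n≡4n+d = trans (ℕₚ.+-comm (2 ^ suc r) (4 ℕ.* n)) (cong (λ k → 4 ℕ.* n ℕ.+ 2 ^ k) (ℕₚ.+-comm 1 r))
  part₂ : ∀ r → r ≥ 1 → ∃ λ n₀ → n₀ ≥ 1 × (∀ n → n ≥ n₀ →
          + (3 ^ r) ℤᵘ.∣ 𝓔 6 (6 ℕ.* n ℕ.+ 2 ℕ.* 3 ^ r) - 𝓔 6 (6 ℕ.* n))
  part₂ r _ = suc start , s≤s z≤n , λ n 1+start≤n →
    ∣⇒∣ᵤ {i = 𝓔 6 (6 ℕ.* n ℕ.+ 2 ℕ.* 3 ^ r) - 𝓔 6 (6 ℕ.* n)}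
    (subst (λ k → + (3 ^ r) ∣ 𝓔 6 k - 𝓔 6 (6 ℕ.* n)) (ℕₚ.+-comm (2 ℕ.* 3 ^ r) (6 ℕ.* n))
      (periodic (6 ℕ.* n) (ℕₚ.≤-trans (ℕₚ.<⇒≤ 1+start≤n) (ℕₚ.m≤n*m n 6))))
    where open EventuallyPeriodic (𝓔₆-eventuallyPeriodic r)
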